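{- Let $G$ be a minimum counterexample (for given integers $t,\Delta$ with $3 \le t \le \Delta+1$). Then every edge of $G$ lies in a copy of $K_t$.
   Context: All graphs are finite, simple, and without isolated vertices (graphs are identified if isomorphic after deleting isolated vertices). $k_t(H)$ is the number of copies of $K_t$ in $H$; $\binom{y}{k}=y(y-1)\cdots(y-k+1)/k!$. For $m=\binom{r}{2}+s$ with $0\le s<r$, the colex graph $L_m$ is a clique $K_r$ plus one extra vertex adjacent to exactly $s$ clique vertices ($L_0$ empty). The family $\mathcal{L}_{t,\Delta}(m)$: for $m=0$ it is the empty graph; for $0<m\le\binom{\Delta+1}{2}$, $m=\binom{r}{2}+s$, $0\le s<r$: if $s\ge t-1$ it is $\{L_m\}$; if $r\ge t$, $s<t-1$ it is $L_m$ and all $m$-edge graphs of maximum degree $\le\Delta$ containing $K_r$; if $r<t$ it is $L_m$ and all $m$-edge graphs of maximum degree $\le\Delta$. Fix integers $3\le t\le \Delta+1$. A minimum counterexample is a graph $G$ such that: (i) $G$ has maximum degree at most $\Delta$; (ii) $|E(G)| = q\binom{\Delta+1}{2}+\binom{r}{2}+s$ with integers $q\ge 1$ and $0\le s<r\le\Delta$; (iii) $k_t(G)\ge T_t:=q\binom{\Delta+1}{t}+\binom{r}{t}+\binom{s}{t-1}$; (iv) $G$ is not isomorphic to $qK_{\Delta+1}\cup L$ for any $L\in\mathcal{L}_{t,\Delta}(\binom{r}{2}+s)$; (v) every graph $G'$ of maximum degree $\le \Delta$ with fewer edges than $G$, writing $|E(G')|=q'\binom{\Delta+1}{2}+b'$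 with $0\le b'<\binom{\Delta+1}{2}$, satisfies $k_t(G')\le k_t(q'K_{\Delta+1}\cup L_{b'})$, with equality only if $G'\cong q'K_{\Delta+1}\cup L$ for some $L\in\mathcal{L}_{t,\Delta}(b')$; (vi) every graph with maximum degree $\le\Delta$ and the same number of edges as $G$ has at most $k_t(G)$ copies of $K_t$. -}

module Defs where

open import Data.Bool using (Bool; true; false; _∧_; _∨_; not; if_then_else_; T)
open import Data.Nat using (ℕ; zero; suc; _+_; _*_; _∸_; _≤_; _<_; _<ᵇ_)
open import Data.Nat.Combinatorics using (_C_)
open import Data.Fin using (Fin; zero; suc; toℕ; fromℕ; splitAt; _≟_)
open import Data.Sum using (_⊎_; inj₁; inj₂)
open import Data.Product using (Σ; _×_; _,_; proj₁; ∃)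
open import Data.Vec using (Vec; []; _∷_; lookup)
open import Data.List using (List; []; _∷_; _++_; map)
open import Function.Bundles using (_↔_; Inverse)
open import Relation.Nullary using (¬_; does)
open import Relation.Binary.PropositionalEquality using (_≡_; _≢_)

record Graph : Set where
  constructor mkGraph
  field
    n   : ℕ
    adj : Fin n → Fin n → Bool
open Graph public

IsSimple : Graph → Set
IsSimple G = (∀ i j → adj G i j ≡ adj G j i) × (∀ i → adj G i i ≡ false)

sumFin : ∀ {n} → (Fin n → ℕ) → ℕ
sumFin {zero}  f = 0
sumFin {suc n} f = f zero + sumFin (λ i → f (suc i))

countFin : ∀ {n} → (Fin n → Bool) → ℕ
countFin f = sumFin (λ i → if f i then 1 else 0)

anyFin : ∀ {n} → (Fin n → Bool) → Bool
anyFin {zero}  f = false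
anyFin {suc n} f = f zero ∨ anyFin (λ i → f (suc i))

allFin : ∀ {n} → (Fin n → Bool) → Bool
allFin {zero}  f = true
allFin {suc n} f = f zero ∧ allFin (λ i → f (suc i))

_==ᶠ_ : ∀ {n} → Fin n → Fin n → Bool
i ==ᶠ j = does (i ≟ j)

edges : Graph → ℕ
edges G = sumFin (λ i → countFin (λ j → (toℕ i <ᵇ toℕ j) ∧ adj G i j))

degree : (G : Graph) → Fin (n G) → ℕ
degree G i = countFin (adj G i)

MaxDegLe : Graph → ℕ → Set
MaxDegLe G Δ = ∀ i → degree G i ≤ Δ

subsets : ∀ m → List (Vec Bool m)
subsets zero    = [] ∷ []
subsets (suc m) = map (true ∷_) (subsets m) ++ map (false ∷_) (subsets m)

size : ∀ {m} → Vec Bool m → ℕ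
size []          = 0
size (b ∷ v) = (if b then 1 else 0) + size v

isCliqueB : (G : Graph) → Vec Bool (n G) → Bool
isCliqueB G S = allFin (λ i → allFin (λ j →
  not (lookup S i ∧ lookup S j ∧ not (i ==ᶠ j)) ∨ adj G i j))

countList : ∀ {A : Set} → (A → Bool) → List A → ℕ
countList p []       = 0
countList p (x ∷ xs) = (if p x then 1 else 0) + countList p xs

sizeIs : ∀ {m} → ℕ → Vec Bool m → Bool
sizeIs t S = does (Data.Nat._≟_ (size S) t)

kt : ℕ → Graph → ℕ
kt t G = countList (λ S → sizeIs t S ∧ isCliqueB G S) (subsets (n G))

ContainsK : ℕ → Graph → Set
ContainsK r G = Σ (Fin r → Fin (n G)) λ f → ∀ i j → i ≢ j → adj G (f i) (f j) ≡ true

-- Isomorphism after deleting isolated vertices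

nonIsolated : (G : Graph) → Fin (n G) → Bool
nonIsolated G i = anyFin (adj G i)

V* : Graph → Set
V* G = Σ (Fin (n G)) (λ i → T (nonIsolated G i))

_≅_ : Graph → Graph → Set
G ≅ H = Σ (V* G ↔ V* H) λ f →
  ∀ u v → adj H (proj₁ (Inverse.to f u)) (proj₁ (Inverse.to f v)) ≡ adj G (proj₁ u) (proj₁ v)

emptyGraph : Graph
emptyGraph = mkGraph 0 (λ ())

K : ℕ → Graph
K m = mkGraph m (λ i j → not (i ==ᶠ j))

_∪_ : Graph → Graph → Graph
G ∪ H = mkGraph (n G + n H) (λ i j → a (splitAt (n G) i) (splitAt (n G) j))
  where
  a : Fin (n G) ⊎ Fin (n H) → Fin (n G) ⊎ Fin (n H) → Bool
  a (inj₁ x) (inj₁ y) = adj G x y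
  a (inj₂ x) (inj₂ y) = adj H x y
  a _        _        = false

qK : ℕ → ℕ → Graph
qK zero    Δ = emptyGraph
qK (suc q) Δ = K (suc Δ) ∪ qK q Δ

-- colex graph for m = C(r,2) + s (0 ≤ s < r): clique on vertices 0..r-1 plus
-- vertex r adjacent to exactly the clique vertices 0..s-1
-- (for s = 0 the extra vertex is isolated, hence deleted up to ≅)
colex : ℕ → ℕ → Graph
colex r s = mkGraph (suc r) λ i j → not (i ==ᶠ j) ∧ ok (toℕ i) (toℕ j)
  where
  lt : ℕ → ℕ → Bool
  lt a b = a <ᵇ b
  ok : ℕ → ℕ → Bool
  ok a b = (lt a r ∧ lt b r) ∨ (lt a r ∧ lt a s) ∨ (lt b r ∧ lt b s)

-- The family 𝓛_{t,Δ}(m) (membership predicate on graphs, up to ≅)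

InFam : ℕ → ℕ → ℕ → Graph → Set
InFam t Δ m H =
  (m ≡ 0 × H ≅ emptyGraph)
  ⊎ Σ ℕ λ r → Σ ℕ λ s →
      s < r × m ≡ r C 2 + s × 0 < m × m ≤ suc Δ C 2 ×
      ( (t ∸ 1 ≤ s × H ≅ colex r s)
      ⊎ (t ≤ r × s < t ∸ 1 ×
           (H ≅ colex r s ⊎ (IsSimple H × edges H ≡ m × MaxDegLe H Δ × ContainsK r H)))
      ⊎ (r < t ×
           (H ≅ colex r s ⊎ (IsSimple H × edges H ≡ m × MaxDegLe H Δ))))

record MinCounterexample (t Δ : ℕ) (G : Graph) : Set₁ where
  field
    simple : IsSimple G
    maxDeg : MaxDegLe G Δ
    q r s  : ℕ
    q≥1    : 1 ≤ q
    s<r    : s < r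
    r≤Δ    : r ≤ Δ
    edgesG : edges G ≡ q * (suc Δ C 2) + (r C 2 + s)
    many   : q * (suc Δ C t) + r C t + s C (t ∸ 1) ≤ kt t G
    notExt : ¬ (Σ Graph λ L → InFam t Δ (r C 2 + s) L × G ≅ (qK q Δ ∪ L))
    minimal : ∀ (G' : Graph) → IsSimple G' → MaxDegLe G' Δ → edges G' < edges G →
      ∀ q' b' → b' < suc Δ C 2 → edges G' ≡ q' * (suc Δ C 2) + b' →
      ∀ r' s' → s' < r' → b' ≡ r' C 2 + s' →
        (kt t G' ≤ kt t (qK q' Δ ∪ colex r' s'))
        × (kt t G' ≡ kt t (qK q' Δ ∪ colex r' s') →
             Σ Graph λ L → InFam t Δ b' L × G' ≅ (qK q' Δ ∪ L))
    optimal : ∀ (G' : Graph) → IsSimple G' → MaxDegLe G' Δ → edges G' ≡ edges G →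
      kt t G' ≤ kt t G

-- Suppose the edge uv lies in no K_t. Deleting it leaves k_t unchanged and lowers |E| by one, so by
-- minimality the smaller graph G′ has at most the extremal number of K_t's for |E| - 1 edges. Writing
-- |E| - 1 in the form q′ C(Δ+1,2) + C(r′,2) + s′, Pascal's rule shows that the extremal count for |E|
-- exceeds that for |E| - 1 by C(s-1, t-2), C(r-2, t-2) or C(Δ-1, t-2), according as s > 0, or s = 0 and
-- r ≥ 2, or s = 0 and r = 1. The last is positive, a contradiction. Otherwise it must vanish, so G′ is
-- extremal: G′ ≅ qK_{Δ+1} ∪ L with L in the family. The endpoints u and v have degree below Δ in G′, hence
-- lie in L, and since the copies of K_{Δ+1} are components, putting uv back gives G ≅ qK_{Δ+1} ∪ L′ with
-- L′ ≅ L + uv. The vanishing condition (s < t - 1, resp. r < t), together with K_r ⊆ L when r ≥ t, places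
-- L′ in the family for |E|, contradicting the choice of G.

module Submission where

open import Defs
open import Data.Bool using (Bool; true; false; _∧_; _∨_; not; if_then_else_; T)
open import Data.Bool.Properties
  using (not-injective; ∧-identityʳ; ∧-zeroʳ; ∧-comm; ∨-comm; ∨-identityʳ; ¬-not; T-irrelevant; T-≡)
open import Data.Nat
  using (ℕ; zero; suc; _+_; _*_; _∸_; _≤_; _<_; _<ᵇ_; z≤n; s≤s; ⌊_/2⌋; _≤′_; ≤′-refl; ≤′-step)
open import Data.Nat.Properties hiding (_≟_)
open import Data.Nat.Combinatorics using (_C_; nCk+nC[k+1]≡[n+1]C[k+1]; nC1≡n; k>n⇒nCk≡0)
open import Data.Fin using (Fin; zero; suc; toℕ; _↑ˡ_; _↑ʳ_; splitAt; inject₁; punchOut; _≟_)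
import Data.Fin.Properties as Fin
open import Data.Vec using (Vec; _∷_; lookup)
open import Data.List using ([]; _∷_; _++_; map)
open import Data.Empty using (⊥; ⊥-elim)
open import Data.Product using (Σ; _×_; _,_; proj₁; proj₂)
open import Data.Sum using (_⊎_; inj₁; inj₂; [_,_])
open import Function.Bundles using (Inverse; mk↔ₛ′; Equivalence)
open import Relation.Nullary using (yes; no)
open import Relation.Binary using (tri<; tri≈; tri>)
open import Relation.Nullary.Decidable using (dec-true; dec-false)
open import Relation.Binary.PropositionalEquality hiding ([_])
open import Function using (_∘_; id)
open import Algebra.Properties.CommutativeSemigroup +-commutativeSemigroup using (interchange; xy∙z≈xz∙y)
open import Data.Nat.Solver using (module +-*-Solver)
open +-*-Solver using (solve; _:+_; _:=_; con)

true≢false : true ≢ false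
true≢false ()

≢true⇒≡false : ∀ {a} → a ≢ true → a ≡ false
≢true⇒≡false = ¬-not

∧-true⁻ : ∀ {a b} → a ∧ b ≡ true → a ≡ true × b ≡ true
∧-true⁻ {true} {true} _ = refl , refl

∧-true⁺ : ∀ {a b} → a ≡ true → b ≡ true → a ∧ b ≡ true
∧-true⁺ refl refl = refl

∨-true⁻ : ∀ {a b} → a ∨ b ≡ true → a ≡ true ⊎ b ≡ true
∨-true⁻ {true}  _ = inj₁ refl
∨-true⁻ {false} p = inj₂ p

∨-trueʳ : ∀ a {b} → b ≡ true → a ∨ b ≡ true
∨-trueʳ true  _    = refl
∨-trueʳ false refl = refl

true⇔true⇒≡ : ∀ {a b} → (a ≡ true → b ≡ true) → (b ≡ true → a ≡ true) → a ≡ b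
true⇔true⇒≡ {false} {false} _ _ = refl
true⇔true⇒≡ {false} {true}  _ g = g refl
true⇔true⇒≡ {true}  {false} f _ = sym (f refl)
true⇔true⇒≡ {true}  {true}  _ _ = refl

T→≡ : ∀ {b} → T b → b ≡ true
T→≡ = Equivalence.to T-≡

≡→T : ∀ {b} → b ≡ true → T b
≡→T = Equivalence.from T-≡

ι : Bool → ℕ
ι b = if b then 1 else 0

==ᶠ-refl : ∀ {n} (i : Fin n) → (i ==ᶠ i) ≡ true
==ᶠ-refl i = dec-true (i ≟ i) refl

≢⇒==ᶠ-false : ∀ {n} {i j : Fin n} → i ≢ j → (i ==ᶠ j) ≡ false
≢⇒==ᶠ-false {i = i} {j} = dec-false (i ≟ j)

==ᶠ⇒≡ : ∀ {n} {i j : Fin n} → (i ==ᶠ j) ≡ true → i ≡ j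
==ᶠ⇒≡ {i = i} {j} e with i ≟ j
... | yes i≡j = i≡j

==ᶠ-sym : ∀ {n} (i j : Fin n) → (i ==ᶠ j) ≡ (j ==ᶠ i)
==ᶠ-sym i j with i ≟ j | j ≟ i
... | yes _   | yes _   = refl
... | no  _   | no  _   = refl
... | yes i≡j | no  j≢i = ⊥-elim (j≢i (sym i≡j))
... | no  i≢j | yes j≡i = ⊥-elim (i≢j (sym j≡i))

-- Finite sums and counts

sumFin-cong : ∀ {n} {f g : Fin n → ℕ} → (∀ i → f i ≡ g i) → sumFin f ≡ sumFin g
sumFin-cong {zero}  e = refl
sumFin-cong {suc n} e = cong₂ _+_ (e zero) (sumFin-cong (λ i → e (suc i)))

sumFin-+ : ∀ {n} (f g : Fin n → ℕ) → sumFin (λ i → f i + g i) ≡ sumFin f + sumFin g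
sumFin-+ {zero}  f g = refl
sumFin-+ {suc n} f g = begin
  f zero + g zero + sumFin (λ i → f (suc i) + g (suc i))
    ≡⟨ cong (f zero + g zero +_) (sumFin-+ (λ i → f (suc i)) (λ i → g (suc i))) ⟩
  f zero + g zero + (sumFin (λ i → f (suc i)) + sumFin (λ i → g (suc i)))
    ≡⟨ interchange (f zero) (g zero) _ _ ⟩
  f zero + sumFin (λ i → f (suc i)) + (g zero + sumFin (λ i → g (suc i))) ∎
  where open ≡-Reasoning

sumFin-mono : ∀ {n} {f g : Fin n → ℕ} → (∀ i → f i ≤ g i) → sumFin f ≤ sumFin g
sumFin-mono {zero}  _ = z≤n
sumFin-mono {suc n} e = +-mono-≤ (e zero) (sumFin-mono (λ i → e (suc i)))

sumFin-zero : ∀ {n} {f : Fin n → ℕ} → (∀ i → f i ≡ 0) → sumFin f ≡ 0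
sumFin-zero {zero}  _ = refl
sumFin-zero {suc n} e = cong₂ _+_ (e zero) (sumFin-zero (λ i → e (suc i)))

sumFin-swap : ∀ {n m} (f : Fin n → Fin m → ℕ) →
  sumFin (λ i → sumFin (f i)) ≡ sumFin (λ j → sumFin (λ i → f i j))
sumFin-swap {zero} {m} f = sym (sumFin-zero {m} (λ _ → refl))
sumFin-swap {suc n} f =
  trans (cong (sumFin (f zero) +_) (sumFin-swap (λ i → f (suc i))))
        (sym (sumFin-+ (f zero) (λ j → sumFin (λ i → f (suc i) j))))

sumFin-↑ : ∀ m k (f : Fin (m + k) → ℕ) →
  sumFin f ≡ sumFin (λ i → f (i ↑ˡ k)) + sumFin (λ j → f (m ↑ʳ j))
sumFin-↑ zero    k f = refl
sumFin-↑ (suc m) k f =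
  trans (cong (f zero +_) (sumFin-↑ m k (λ i → f (suc i)))) (sym (+-assoc (f zero) _ _))

sumFin-indicator : ∀ {n} (k : Fin n) (c : ℕ) → sumFin (λ i → if i ==ᶠ k then c else 0) ≡ c
sumFin-indicator {suc n} zero    c = trans (cong (c +_) (sumFin-zero {n} (λ _ → refl))) (+-identityʳ c)
sumFin-indicator {suc n} (suc k) c = sumFin-indicator k c

countFin-cong : ∀ {n} {f g : Fin n → Bool} → (∀ i → f i ≡ g i) → countFin f ≡ countFin g
countFin-cong e = sumFin-cong (λ i → cong ι (e i))

countFin-mono : ∀ {n} {f g : Fin n → Bool} → (∀ i → f i ≡ true → g i ≡ true) → countFin f ≤ countFin g
countFin-mono {f = f} {g} f⊆g = sumFin-mono pointwise
  where
  pointwise : ∀ i → ι (f i) ≤ ι (g i)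
  pointwise i with f i in fi
  ... | false = z≤n
  ... | true rewrite f⊆g i fi = ≤-refl

countFin-false : ∀ {n} {f : Fin n → Bool} → (∀ i → f i ≡ false) → countFin f ≡ 0
countFin-false e = sumFin-zero (λ i → cong ι (e i))

countFin-true : ∀ n → countFin {n} (λ _ → true) ≡ n
countFin-true zero    = refl
countFin-true (suc n) = cong suc (countFin-true n)

countFin-≡ : ∀ {n} (k : Fin n) → countFin (λ i → i ==ᶠ k) ≡ 1
countFin-≡ k = sumFin-indicator k 1

countFin-≢ : ∀ n (k : Fin (suc n)) → countFin (λ i → not (k ==ᶠ i)) ≡ n
countFin-≢ n       zero    = countFin-true n
countFin-≢ (suc n) (suc k) = cong suc (countFin-≢ n k)

countFin-↑ : ∀ m k (f : Fin (m + k) → Bool) →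
  countFin f ≡ countFin (λ i → f (i ↑ˡ k)) + countFin (λ j → f (m ↑ʳ j))
countFin-↑ m k f = sumFin-↑ m k (λ i → ι (f i))

countFin-pos : ∀ {n} (f : Fin n → Bool) → 1 ≤ countFin f → Σ (Fin n) λ i → f i ≡ true
countFin-pos {suc n} f pos with f zero in f0
... | true  = zero , f0
... | false = let (i , fi) = countFin-pos (λ i → f (suc i)) pos in suc i , fi

anyFin⁻ : ∀ {n} {f : Fin n → Bool} → anyFin f ≡ true → Σ (Fin n) λ i → f i ≡ true
anyFin⁻ {suc n} {f} e with f zero in f0
... | true  = zero , f0
... | false = let (i , fi) = anyFin⁻ {f = λ i → f (suc i)} e in suc i , fi

anyFin⁺ : ∀ {n} {f : Fin n → Bool} (i : Fin n) → f i ≡ true → anyFin f ≡ true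
anyFin⁺ {f = f} zero    e rewrite e = refl
anyFin⁺ {f = f} (suc i) e = ∨-trueʳ (f zero) (anyFin⁺ {f = λ i → f (suc i)} i e)

anyFin-false⇒countFin-zero : ∀ {n} {f : Fin n → Bool} → anyFin f ≡ false → countFin f ≡ 0
anyFin-false⇒countFin-zero {f = f} e =
  countFin-false (λ i → ≢true⇒≡false (λ fi → true≢false (trans (sym (anyFin⁺ {f = f} i fi)) e)))

allFin⁻ : ∀ {n} {f : Fin n → Bool} → allFin f ≡ true → ∀ i → f i ≡ true
allFin⁻ {f = f} e zero    = proj₁ (∧-true⁻ e)
allFin⁻ {f = f} e (suc i) = allFin⁻ {f = λ i → f (suc i)} (proj₂ (∧-true⁻ {f zero} e)) i

allFin⁺ : ∀ {n} {f : Fin n → Bool} → (∀ i → f i ≡ true) → allFin f ≡ true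
allFin⁺ {zero}      _ = refl
allFin⁺ {suc n} {f} e = ∧-true⁺ (e zero) (allFin⁺ {f = λ i → f (suc i)} (λ i → e (suc i)))

allFin-cong : ∀ {n} {f g : Fin n → Bool} → (∀ i → f i ≡ g i) → allFin f ≡ allFin g
allFin-cong {zero}  _ = refl
allFin-cong {suc n} e = cong₂ _∧_ (e zero) (allFin-cong (λ i → e (suc i)))

countList-cong : ∀ {A : Set} {p q : A → Bool} → (∀ x → p x ≡ q x) → ∀ xs →
  countList p xs ≡ countList q xs
countList-cong e []       = refl
countList-cong e (x ∷ xs) = cong₂ _+_ (cong ι (e x)) (countList-cong e xs)

countList-false : ∀ {A : Set} {p : A → Bool} → (∀ x → p x ≡ false) → ∀ xs → countList p xs ≡ 0
countList-false e []       = refl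
countList-false e (x ∷ xs) rewrite e x = countList-false e xs

countList-++ : ∀ {A : Set} (p : A → Bool) xs ys → countList p (xs ++ ys) ≡ countList p xs + countList p ys
countList-++ p []       ys = refl
countList-++ p (x ∷ xs) ys = trans (cong (ι (p x) +_) (countList-++ p xs ys)) (sym (+-assoc (ι (p x)) _ _))

countList-map : ∀ {A B : Set} (p : B → Bool) (f : A → B) xs →
  countList p (map f xs) ≡ countList (λ x → p (f x)) xs
countList-map p f []       = refl
countList-map p f (x ∷ xs) = cong (ι (p (f x)) +_) (countList-map p f xs)

countList-subsets : ∀ m (p : Vec Bool (suc m) → Bool) →
  countList p (subsets (suc m))
    ≡ countList (λ S → p (true ∷ S)) (subsets m) + countList (λ S → p (false ∷ S)) (subsets m)
countList-subsets m p = trans (countList-++ p (map (true ∷_) (subsets m)) _)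
  (cong₂ _+_ (countList-map p (true ∷_) (subsets m)) (countList-map p (false ∷_) (subsets m)))

-- Cliques inside a vertex set

Adj : ℕ → Set
Adj n = Fin n → Fin n → Bool

IsClique : ∀ {n} → Adj n → Vec Bool n → Set
IsClique a S = ∀ i j → lookup S i ≡ true → lookup S j ≡ true → i ≢ j → a i j ≡ true

isCliqueB⁻ : ∀ {n} (a : Adj n) S → isCliqueB (mkGraph n a) S ≡ true → IsClique a S
isCliqueB⁻ a S e i j si sj i≢j = entry (allFin⁻ (allFin⁻ e i) j)
  where
  entry : not (lookup S i ∧ lookup S j ∧ not (i ==ᶠ j)) ∨ a i j ≡ true → a i j ≡ true
  entry p rewrite si | sj | ≢⇒==ᶠ-false i≢j = p

isCliqueB⁺ : ∀ {n} (a : Adj n) S → IsClique a S → isCliqueB (mkGraph n a) S ≡ true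
isCliqueB⁺ a S c = allFin⁺ (λ i → allFin⁺ (entry i))
  where
  entry : ∀ i j → not (lookup S i ∧ lookup S j ∧ not (i ==ᶠ j)) ∨ a i j ≡ true
  entry i j with lookup S i in si | lookup S j in sj | i ≟ j
  ... | false | _     | _       = refl
  ... | true  | false | _       = refl
  ... | true  | true  | yes _   = refl
  ... | true  | true  | no  i≢j = ∨-trueʳ false (c i j si sj i≢j)

isCliqueB-cong : ∀ {n} {a b : Adj n} → (∀ i j → a i j ≡ b i j) → ∀ S →
  isCliqueB (mkGraph n a) S ≡ isCliqueB (mkGraph n b) S
isCliqueB-cong e S = allFin-cong (λ i → allFin-cong (λ j → cong (_ ∨_) (e i j)))

insideB : ∀ {n} → (Fin n → Bool) → Vec Bool n → Bool
insideB P S = allFin (λ i → not (lookup S i) ∨ P i)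

insideB-cong : ∀ {n} {P Q : Fin n → Bool} → (∀ i → P i ≡ Q i) → ∀ S → insideB P S ≡ insideB Q S
insideB-cong e S = allFin-cong (λ i → cong (_ ∨_) (e i))

insideB⁻ : ∀ {n} (P : Fin n → Bool) S → insideB P S ≡ true → ∀ i → lookup S i ≡ true → P i ≡ true
insideB⁻ P S e i si = entry (allFin⁻ e i)
  where
  entry : not (lookup S i) ∨ P i ≡ true → P i ≡ true
  entry p rewrite si = p

insideB⁺ : ∀ {n} (P : Fin n → Bool) S → (∀ i → lookup S i ≡ true → P i ≡ true) → insideB P S ≡ true
insideB⁺ P S c = allFin⁺ entry
  where
  entry : ∀ i → not (lookup S i) ∨ P i ≡ true
  entry i with lookup S i in si
  ... | false = refl
  ... | true  = c i si

ktOn : ℕ → (n : ℕ) → Adj n → (Fin n → Bool) → ℕ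
ktOn t n a P = countList (λ S → sizeIs t S ∧ isCliqueB (mkGraph n a) S ∧ insideB P S) (subsets n)

kt≡ktOn : ∀ t G → kt t G ≡ ktOn t (n G) (adj G) (λ _ → true)
kt≡ktOn t G = countList-cong (λ S → cong (sizeIs t S ∧_) (sym (trans
  (cong (isCliqueB G S ∧_) (insideB⁺ (λ _ → true) S (λ _ _ → refl))) (∧-identityʳ _)))) (subsets (n G))

ktOn-cong : ∀ t n {a b : Adj n} {P Q : Fin n → Bool} →
  (∀ i j → a i j ≡ b i j) → (∀ i → P i ≡ Q i) → ktOn t n a P ≡ ktOn t n b Q
ktOn-cong t n ea eP = countList-cong
  (λ S → cong₂ (λ c d → sizeIs t S ∧ c ∧ d) (isCliqueB-cong ea S) (insideB-cong eP S)) (subsets n)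

ktOn-outside : ∀ t n a (P : Fin n → Bool) → (∀ i → P i ≡ false) → ktOn (suc t) n a P ≡ 0
ktOn-outside t n a P P-false = countList-false noClique (subsets n)
  where
  member : ∀ {m} (S : Vec Bool m) → sizeIs (suc t) S ≡ true → Σ (Fin m) λ i → lookup S i ≡ true
  member (true  ∷ S) _ = zero , refl
  member (false ∷ S) e = let (i , si) = member S e in suc i , si
  noClique : ∀ S → sizeIs (suc t) S ∧ isCliqueB (mkGraph n a) S ∧ insideB P S ≡ false
  noClique S with sizeIs (suc t) S in size≡
  ... | false = refl
  ... | true with isCliqueB (mkGraph n a) S
  ... | false = refl
  ... | true  = ≢true⇒≡false (λ inside →
    let (i , si) = member S size≡ in true≢false (trans (sym (insideB⁻ P S inside i si)) (P-false i)))

dropVertex : ∀ {n} → Adj (suc n) → Adj n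
dropVertex a i j = a (suc i) (suc j)

adjacent₀ : ∀ {n} → Adj (suc n) → Fin n → Bool
adjacent₀ a j = a zero (suc j) ∧ a (suc j) zero

isCliqueB-false∷ : ∀ {n} (a : Adj (suc n)) S →
  isCliqueB (mkGraph (suc n) a) (false ∷ S) ≡ isCliqueB (mkGraph n (dropVertex a)) S
isCliqueB-false∷ a S = true⇔true⇒≡
  (λ e → isCliqueB⁺ (dropVertex a) S (λ i j si sj i≢j →
     isCliqueB⁻ a (false ∷ S) e (suc i) (suc j) si sj (λ eq → i≢j (Fin.suc-injective eq))))
  (λ e → isCliqueB⁺ a (false ∷ S) (clique (isCliqueB⁻ (dropVertex a) S e)))
  where
  clique : IsClique (dropVertex a) S → IsClique a (false ∷ S)
  clique c (suc i) (suc j) si sj i≢j = c i j si sj (λ eq → i≢j (cong suc eq))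

isCliqueB-true∷ : ∀ {n} (a : Adj (suc n)) S Q →
  isCliqueB (mkGraph (suc n) a) (true ∷ S) ∧ insideB Q S
    ≡ isCliqueB (mkGraph n (dropVertex a)) S ∧ insideB (λ j → Q j ∧ adjacent₀ a j) S
isCliqueB-true∷ a S Q = true⇔true⇒≡
  (λ e → let (cl , inQ) = ∧-true⁻ e ; c = isCliqueB⁻ a (true ∷ S) cl in
     ∧-true⁺ (isCliqueB⁺ (dropVertex a) S
                (λ i j si sj i≢j → c (suc i) (suc j) si sj (λ eq → i≢j (Fin.suc-injective eq))))
             (insideB⁺ _ S (λ j sj → ∧-true⁺ (insideB⁻ Q S inQ j sj)
               (∧-true⁺ (c zero (suc j) refl sj (λ ())) (c (suc j) zero sj refl (λ ()))))))
  (λ e → let (cl , inQ) = ∧-true⁻ e ; inQ₀ = insideB⁻ _ S inQ in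
     ∧-true⁺ (isCliqueB⁺ a (true ∷ S)
                (clique (isCliqueB⁻ (dropVertex a) S cl) (λ j sj → proj₂ (∧-true⁻ {Q j} (inQ₀ j sj)))))
             (insideB⁺ Q S (λ j sj → proj₁ (∧-true⁻ (inQ₀ j sj)))))
  where
  clique : IsClique (dropVertex a) S → (∀ j → lookup S j ≡ true → adjacent₀ a j ≡ true) →
    IsClique a (true ∷ S)
  clique c adj₀ zero    zero    _  _  i≢j = ⊥-elim (i≢j refl)
  clique c adj₀ zero    (suc j) _  sj _   = proj₁ (∧-true⁻ (adj₀ j sj))
  clique c adj₀ (suc i) zero    si _  _   = proj₂ (∧-true⁻ {a zero (suc i)} (adj₀ i si))
  clique c adj₀ (suc i) (suc j) si sj i≢j = c i j si sj (λ eq → i≢j (cong suc eq))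

ktOn∋₀ : ℕ → (n : ℕ) → Adj (suc n) → (Fin (suc n) → Bool) → ℕ
ktOn∋₀ t n a P =
  countList (λ S → sizeIs t (true ∷ S) ∧ isCliqueB (mkGraph (suc n) a) (true ∷ S) ∧ insideB P (true ∷ S))
            (subsets n)

ktOn-split : ∀ t n (a : Adj (suc n)) P →
  ktOn t (suc n) a P ≡ ktOn∋₀ t n a P + ktOn t n (dropVertex a) (λ i → P (suc i))
ktOn-split t n a P = trans (countList-subsets n _) (cong (ktOn∋₀ t n a P +_)
  (countList-cong (λ S → cong (λ c → sizeIs t S ∧ c ∧ insideB (λ i → P (suc i)) S) (isCliqueB-false∷ a S))
                  (subsets n)))

ktOn-zero : ∀ n a P → ktOn 0 n a P ≡ 1
ktOn-zero zero    a P = refl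
ktOn-zero (suc n) a P = trans (ktOn-split 0 n a P)
  (cong₂ _+_ (countList-false (λ _ → refl) (subsets n)) (ktOn-zero n (dropVertex a) (λ i → P (suc i))))

ktOn-nbr₀ : ℕ → (n : ℕ) → Adj (suc n) → (Fin (suc n) → Bool) → ℕ
ktOn-nbr₀ t n a P = if P zero then ktOn t n (dropVertex a) (λ j → P (suc j) ∧ adjacent₀ a j) else 0

ktOn∋₀-suc : ∀ t n (a : Adj (suc n)) P → ktOn∋₀ (suc t) n a P ≡ ktOn-nbr₀ t n a P
ktOn∋₀-suc t n a P = containing₀ (P zero)
  where
  containing₀ : ∀ p →
    countList (λ S → sizeIs t S ∧ isCliqueB (mkGraph (suc n) a) (true ∷ S) ∧ (p ∧ insideB (λ i → P (suc i)) S))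
              (subsets n)
      ≡ (if p then ktOn t n (dropVertex a) (λ j → P (suc j) ∧ adjacent₀ a j) else 0)
  containing₀ false = countList-false (λ S → trans (cong (sizeIs t S ∧_) (∧-zeroʳ _)) (∧-zeroʳ _)) (subsets n)
  containing₀ true  =
    countList-cong (λ S → cong (sizeIs t S ∧_) (isCliqueB-true∷ a S (λ i → P (suc i)))) (subsets n)

ktOn-suc : ∀ t n (a : Adj (suc n)) P →
  ktOn (suc t) (suc n) a P ≡ ktOn (suc t) n (dropVertex a) (λ i → P (suc i)) + ktOn-nbr₀ t n a P
ktOn-suc t n a P = trans (ktOn-split (suc t) n a P)
  (trans (+-comm (ktOn∋₀ (suc t) n a P) _)
         (cong (ktOn (suc t) n (dropVertex a) (λ i → P (suc i)) +_) (ktOn∋₀-suc t n a P)))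

-- Disjoint unions

joinAdj : ∀ {m k} → Adj m → Adj k → Adj (m + k)
joinAdj {m} {k} a b = adj (mkGraph m a ∪ mkGraph k b)

joinAdj-suc : ∀ {m k} (a : Adj (suc m)) (b : Adj k) i j →
  joinAdj a b (suc i) (suc j) ≡ joinAdj (dropVertex a) b i j
joinAdj-suc {m} a b i j with splitAt m i | splitAt m j
... | inj₁ _ | inj₁ _ = refl
... | inj₁ _ | inj₂ _ = refl
... | inj₂ _ | inj₁ _ = refl
... | inj₂ _ | inj₂ _ = refl

joinAdj-ˡˡ : ∀ {m k} (a : Adj m) (b : Adj k) x y → joinAdj a b (x ↑ˡ k) (y ↑ˡ k) ≡ a x y
joinAdj-ˡˡ {m} {k} a b x y rewrite Fin.splitAt-↑ˡ m x k | Fin.splitAt-↑ˡ m y k = refl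

joinAdj-ʳʳ : ∀ {m k} (a : Adj m) (b : Adj k) x y → joinAdj a b (m ↑ʳ x) (m ↑ʳ y) ≡ b x y
joinAdj-ʳʳ {m} {k} a b x y rewrite Fin.splitAt-↑ʳ m k x | Fin.splitAt-↑ʳ m k y = refl

joinAdj-ˡʳ : ∀ {m k} (a : Adj m) (b : Adj k) x y → joinAdj a b (x ↑ˡ k) (m ↑ʳ y) ≡ false
joinAdj-ˡʳ {m} {k} a b x y rewrite Fin.splitAt-↑ˡ m x k | Fin.splitAt-↑ʳ m k y = refl

joinAdj-ʳˡ : ∀ {m k} (a : Adj m) (b : Adj k) x y → joinAdj a b (m ↑ʳ x) (y ↑ˡ k) ≡ false
joinAdj-ʳˡ {m} {k} a b x y rewrite Fin.splitAt-↑ˡ m y k | Fin.splitAt-↑ʳ m k x = refl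

ktOn-join : ∀ t m k (a : Adj m) (b : Adj k) (P : Fin (m + k) → Bool) →
  ktOn (suc t) (m + k) (joinAdj a b) P
    ≡ ktOn (suc t) m a (λ i → P (i ↑ˡ k)) + ktOn (suc t) k b (λ j → P (m ↑ʳ j))

-- The neighbours of vertex 0 all lie in the left summand.
ktOn-join-adjacent₀ : ∀ t m k (a : Adj (suc m)) (b : Adj k) (P : Fin (suc m + k) → Bool) →
  ktOn t (m + k) (dropVertex (joinAdj a b)) (λ j → P (suc j) ∧ adjacent₀ (joinAdj a b) j)
    ≡ ktOn t m (dropVertex a) (λ j → P (suc (j ↑ˡ k)) ∧ adjacent₀ a j)
ktOn-join-adjacent₀ zero m k a b P = trans (ktOn-zero (m + k) _ _) (sym (ktOn-zero m _ _))
ktOn-join-adjacent₀ (suc t) m k a b P = begin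
  ktOn (suc t) (m + k) (dropVertex (joinAdj a b)) Q
    ≡⟨ ktOn-cong (suc t) (m + k) (joinAdj-suc a b) (λ _ → refl) ⟩
  ktOn (suc t) (m + k) (joinAdj (dropVertex a) b) Q
    ≡⟨ ktOn-join t m k (dropVertex a) b Q ⟩
  ktOn (suc t) m (dropVertex a) (λ i → Q (i ↑ˡ k)) + ktOn (suc t) k b (λ j → Q (m ↑ʳ j))
    ≡⟨ cong₂ _+_ (ktOn-cong (suc t) m (λ _ _ → refl) left) (ktOn-outside t k b _ right) ⟩
  ktOn (suc t) m (dropVertex a) (λ j → P (suc (j ↑ˡ k)) ∧ adjacent₀ a j) + 0
    ≡⟨ +-identityʳ _ ⟩
  ktOn (suc t) m (dropVertex a) (λ j → P (suc (j ↑ˡ k)) ∧ adjacent₀ a j) ∎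
  where
  open ≡-Reasoning
  Q : Fin (m + k) → Bool
  Q j = P (suc j) ∧ adjacent₀ (joinAdj a b) j
  left : ∀ i → Q (i ↑ˡ k) ≡ P (suc (i ↑ˡ k)) ∧ adjacent₀ a i
  left i = cong (P (suc (i ↑ˡ k)) ∧_) (cong₂ _∧_ (joinAdj-ˡˡ a b zero (suc i)) (joinAdj-ˡˡ a b (suc i) zero))
  right : ∀ j → Q (m ↑ʳ j) ≡ false
  right j rewrite joinAdj-ˡʳ {k = k} a b zero j = ∧-zeroʳ (P (suc (m ↑ʳ j)))

ktOn-join t zero    k a b P = refl
ktOn-join t (suc m) k a b P = begin
  ktOn (suc t) (suc (m + k)) (joinAdj a b) P
    ≡⟨ ktOn-suc t (m + k) (joinAdj a b) P ⟩
  ktOn (suc t) (m + k) (dropVertex (joinAdj a b)) (λ i → P (suc i)) + ktOn-nbr₀ t (m + k) (joinAdj a b) P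
    ≡⟨ cong₂ _+_ (trans (ktOn-cong (suc t) (m + k) (joinAdj-suc a b) (λ _ → refl))
                        (ktOn-join t m k (dropVertex a) b (λ i → P (suc i))))
                 (nbr₀-join (P zero)) ⟩
  X + Y + ktOn-nbr₀ t m a (λ i → P (i ↑ˡ k))
    ≡⟨ xy∙z≈xz∙y X Y _ ⟩
  X + ktOn-nbr₀ t m a (λ i → P (i ↑ˡ k)) + Y
    ≡⟨ cong (_+ Y) (ktOn-suc t m a (λ i → P (i ↑ˡ k))) ⟨
  ktOn (suc t) (suc m) a (λ i → P (i ↑ˡ k)) + Y ∎
  where
  open ≡-Reasoning
  X Y : ℕ
  X = ktOn (suc t) m (dropVertex a) (λ i → P (suc (i ↑ˡ k)))
  Y = ktOn (suc t) k b (λ j → P (suc m ↑ʳ j))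
  nbr₀-join : ∀ p →
    (if p then ktOn t (m + k) (dropVertex (joinAdj a b)) (λ j → P (suc j) ∧ adjacent₀ (joinAdj a b) j) else 0)
      ≡ (if p then ktOn t m (dropVertex a) (λ j → P (suc (j ↑ˡ k)) ∧ adjacent₀ a j) else 0)
  nbr₀-join false = refl
  nbr₀-join true  = ktOn-join-adjacent₀ t m k a b P

kt-∪ : ∀ t G H → kt (suc t) (G ∪ H) ≡ kt (suc t) G + kt (suc t) H
kt-∪ t G H = trans (kt≡ktOn (suc t) (G ∪ H))
  (trans (ktOn-join t (n G) (n H) (adj G) (adj H) (λ _ → true))
         (sym (cong₂ _+_ (kt≡ktOn (suc t) G) (kt≡ktOn (suc t) H))))

-- Binomial coefficients

-- s C (t ∸ 1), except that it is 0 (not 1) at t = 0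
_C₋₁_ : ℕ → ℕ → ℕ
s C₋₁ zero  = 0
s C₋₁ suc t = s C t

C-suc : ∀ s t → suc s C t ≡ s C t + s C₋₁ t
C-suc s zero    = refl
C-suc s (suc t) = trans (sym (nCk+nC[k+1]≡[n+1]C[k+1] s t)) (+-comm (s C t) (s C suc t))

C-pos : ∀ n k → k ≤ n → 1 ≤ n C k
C-pos n       zero    _         = s≤s z≤n
C-pos (suc n) (suc k) (s≤s k≤n) =
  ≤-trans (C-pos n k k≤n) (≤-trans (m≤m+n (n C k) (n C suc k)) (≤-reflexive (nCk+nC[k+1]≡[n+1]C[k+1] n k)))

C≡0⇒< : ∀ n k → n C k ≡ 0 → n < k
C≡0⇒< n k e with k ≤? n
... | yes k≤n = ⊥-elim (1+n≰n (subst (1 ≤_) e (C-pos n k k≤n)) )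
... | no  k≰n = ≰⇒> k≰n

C₋₁≡0⇒< : ∀ s k → 1 ≤ k → s C₋₁ k ≡ 0 → s < k ∸ 1
C₋₁≡0⇒< s (suc k) _ e = C≡0⇒< s k e

C₋₁-pos : ∀ s k → 1 ≤ k → k ≤ suc s → 1 ≤ s C₋₁ k
C₋₁-pos s (suc k) _ (s≤s k≤s) = C-pos s k k≤s

<∸1⇒suc< : ∀ {s} k → s < k ∸ 1 → suc s < k
<∸1⇒suc< (suc k) s<k = s≤s s<k

C-mono : ∀ {m m′} k → m ≤ m′ → m C k ≤ m′ C k
C-mono k m≤m′ = mono (≤⇒≤′ m≤m′)
  where
  mono : ∀ {m m′} → m ≤′ m′ → m C k ≤ m′ C k
  mono ≤′-refl          = ≤-refl
  mono (≤′-step {m′} p) =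
    ≤-trans (mono p) (≤-trans (m≤m+n (m′ C k) (m′ C₋₁ k)) (≤-reflexive (sym (C-suc m′ k))))

C2-suc : ∀ m → suc m C 2 ≡ m + m C 2
C2-suc m = trans (sym (nCk+nC[k+1]≡[n+1]C[k+1] m 1)) (cong (_+ m C 2) (nC1≡n m))

-- C(r,2) + s with s < r lies strictly between C(r,2) and C(r+1,2), so (r, s) is determined by it.
C2+<C2 : ∀ r s R → s < r → r ≤ R → r C 2 + s < suc R C 2
C2+<C2 r s R s<r r≤R = begin-strict
  r C 2 + s   <⟨ +-monoʳ-< (r C 2) s<r ⟩
  r C 2 + r   ≡⟨ trans (+-comm (r C 2) r) (sym (C2-suc r)) ⟩
  suc r C 2   ≤⟨ C-mono 2 (s≤s r≤R) ⟩
  suc R C 2   ∎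
  where open ≤-Reasoning

C2+-strict : ∀ r s r′ s′ → s < r → r < r′ → r C 2 + s < r′ C 2 + s′
C2+-strict r s (suc R) s′ s<r (s≤s r≤R) = <-≤-trans (C2+<C2 r s R s<r r≤R) (m≤m+n _ s′)

C2+-injective : ∀ r s r′ s′ → s < r → s′ < r′ → r C 2 + s ≡ r′ C 2 + s′ → r ≡ r′ × s ≡ s′
C2+-injective r s r′ s′ s<r s′<r′ e with <-cmp r r′
... | tri< r<r′ _ _ = ⊥-elim (<-irrefl e (C2+-strict r s r′ s′ s<r r<r′))
... | tri> _ _ r′<r = ⊥-elim (<-irrefl (sym e) (C2+-strict r′ s′ r s s′<r′ r′<r))
... | tri≈ _ refl _ = refl , +-cancelˡ-≡ (r C 2) s s′ e

-- Clique counts of complete and colex graphs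

kt-K : ∀ t m → kt t (K m) ≡ m C t
kt-K t m = trans (kt≡ktOn t (K m)) (ktOn-K t m)
  where
  ktOn-K : ∀ t m → ktOn t m (adj (K m)) (λ _ → true) ≡ m C t
  ktOn-K zero    m       = ktOn-zero m _ _
  ktOn-K (suc t) zero    = refl
  ktOn-K (suc t) (suc m) = begin
    ktOn (suc t) (suc m) (adj (K (suc m))) (λ _ → true)
      ≡⟨ ktOn-suc t m (adj (K (suc m))) (λ _ → true) ⟩
    ktOn (suc t) m (adj (K m)) (λ _ → true) + ktOn t m (adj (K m)) (λ _ → true)
      ≡⟨ cong₂ _+_ (ktOn-K (suc t) m) (ktOn-K t m) ⟩
    m C suc t + m C t
      ≡⟨ +-comm (m C suc t) (m C t) ⟩
    m C t + m C suc t
      ≡⟨ nCk+nC[k+1]≡[n+1]C[k+1] m t ⟩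
    suc m C suc t ∎
    where open ≡-Reasoning

kt-qK : ∀ t q Δ → kt (suc t) (qK q Δ) ≡ q * (suc Δ C suc t)
kt-qK t zero    Δ = refl
kt-qK t (suc q) Δ = trans (kt-∪ t (K (suc Δ)) (qK q Δ)) (cong₂ _+_ (kt-K (suc t) (suc Δ)) (kt-qK t q Δ))

ktOn-nil : ∀ t a P → ktOn t 0 a P ≡ 0 C t
ktOn-nil zero    a P = refl
ktOn-nil (suc t) a P = refl

-- the clique vertices 0, …, r - 1 of colex r s, together with the extra vertex r when c holds
colexPart : ∀ r → Bool → Fin (suc r) → Bool
colexPart r c i = (toℕ i <ᵇ r) ∨ c

ktOn-colex : ∀ r s c t → s ≤ r →
  ktOn t (suc r) (adj (colex r s)) (colexPart r c) ≡ r C t + (if c then s C₋₁ t else 0)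
ktOn-colex r s false zero _ = ktOn-zero (suc r) (adj (colex r s)) (colexPart r false)
ktOn-colex r s true  zero _ = ktOn-zero (suc r) (adj (colex r s)) (colexPart r true)
ktOn-colex zero zero c (suc t) z≤n = trans (ktOn-suc t 0 (adj (colex 0 0)) (colexPart 0 c)) (cong (0 +_) (through₀ c))
  where
  nbr₀ : Bool → Fin 0 → Bool
  nbr₀ c j = colexPart 0 c (suc j) ∧ adjacent₀ (adj (colex 0 0)) j
  through₀ : ∀ c → (if c then ktOn t 0 (dropVertex (adj (colex 0 0))) (nbr₀ c) else 0) ≡ (if c then 0 C t else 0)
  through₀ false = refl
  through₀ true  = ktOn-nil t (dropVertex (adj (colex 0 0))) (nbr₀ true)
ktOn-colex (suc r) (suc s) c (suc t) (s≤s s≤r) = begin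
  ktOn (suc t) (suc (suc r)) (adj (colex (suc r) (suc s))) (colexPart (suc r) c)
    ≡⟨ ktOn-suc t (suc r) (adj (colex (suc r) (suc s))) (colexPart (suc r) c) ⟩
  ktOn (suc t) (suc r) (adj (colex r s)) (colexPart r c)
    + ktOn t (suc r) (adj (colex r s)) (λ j → colexPart (suc r) c (suc j) ∧ adjacent₀ (adj (colex (suc r) (suc s))) j)
    ≡⟨ cong₂ _+_ (ktOn-colex r s c (suc t) s≤r)
                 (trans (ktOn-cong t (suc r) {a = adj (colex r s)} (λ _ _ → refl) adjacent-all)
                        (ktOn-colex r s c t s≤r)) ⟩
  r C suc t + (if c then s C t else 0) + (r C t + (if c then s C₋₁ t else 0))
    ≡⟨ pascal c ⟩
  suc r C suc t + (if c then suc s C t else 0) ∎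
  where
  open ≡-Reasoning
  -- for s ≥ 1 vertex 0 is adjacent to every other vertex, the extra one included
  adjacent-all : ∀ j → colexPart (suc r) c (suc j) ∧ adjacent₀ (adj (colex (suc r) (suc s))) j ≡ colexPart r c j
  adjacent-all j with toℕ j <ᵇ r
  ... | false = ∧-identityʳ c
  ... | true  = refl
  pascal : ∀ c → r C suc t + (if c then s C t else 0) + (r C t + (if c then s C₋₁ t else 0))
                   ≡ suc r C suc t + (if c then suc s C t else 0)
  pascal false = trans (cong₂ _+_ (+-identityʳ (r C suc t)) (+-identityʳ (r C t)))
    (trans (+-comm (r C suc t) (r C t)) (trans (nCk+nC[k+1]≡[n+1]C[k+1] r t) (sym (+-identityʳ _))))
  pascal true  = trans (interchange (r C suc t) (s C t) (r C t) (s C₋₁ t))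
    (cong₂ _+_ (trans (+-comm (r C suc t) (r C t)) (nCk+nC[k+1]≡[n+1]C[k+1] r t)) (sym (C-suc s t)))
ktOn-colex (suc r) zero c (suc t) z≤n = begin
  ktOn (suc t) (suc (suc r)) (adj (colex (suc r) zero)) (colexPart (suc r) c)
    ≡⟨ ktOn-suc t (suc r) (adj (colex (suc r) zero)) (colexPart (suc r) c) ⟩
  ktOn (suc t) (suc r) (adj (colex r zero)) (colexPart r c)
    + ktOn t (suc r) (adj (colex r zero)) (λ j → colexPart (suc r) c (suc j) ∧ adjacent₀ (adj (colex (suc r) zero)) j)
    ≡⟨ cong₂ _+_ (ktOn-colex r zero c (suc t) z≤n)
                 (trans (ktOn-cong t (suc r) {a = adj (colex r zero)} (λ _ _ → refl) adjacent-clique)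
                        (ktOn-colex r zero false t z≤n)) ⟩
  r C suc t + (if c then 0 C t else 0) + (r C t + 0)
    ≡⟨ pascal (if c then 0 C t else 0) ⟩
  suc r C suc t + (if c then 0 C t else 0) ∎
  where
  open ≡-Reasoning
  -- for s = 0 the extra vertex is isolated, so vertex 0 is adjacent exactly to the other clique vertices
  adjacent-clique : ∀ j →
    colexPart (suc r) c (suc j) ∧ adjacent₀ (adj (colex (suc r) zero)) j ≡ colexPart r false j
  adjacent-clique j with toℕ j <ᵇ r
  ... | false = ∧-zeroʳ c
  ... | true  = refl
  pascal : ∀ x → r C suc t + x + (r C t + 0) ≡ suc r C suc t + x
  pascal x = trans (cong (r C suc t + x +_) (+-identityʳ (r C t)))
    (trans (xy∙z≈xz∙y (r C suc t) x (r C t))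
    (cong (_+ x) (trans (+-comm (r C suc t) (r C t)) (nCk+nC[k+1]≡[n+1]C[k+1] r t))))

kt-colex : ∀ t r s → s ≤ r → kt (suc t) (colex r s) ≡ r C suc t + s C t
kt-colex t r s s≤r = trans (kt≡ktOn (suc t) (colex r s))
  (trans (ktOn-cong (suc t) (suc r) {a = adj (colex r s)} (λ _ _ → refl)
                    (λ i → sym (∨-trueʳ (toℕ i <ᵇ r) refl)))
         (ktOn-colex r s true (suc t) s≤r))

-- Edges and degrees

edges-cong : ∀ {n} {a b : Adj n} → (∀ i j → a i j ≡ b i j) → edges (mkGraph n a) ≡ edges (mkGraph n b)
edges-cong e = sumFin-cong (λ i → countFin-cong (λ j → cong (_ ∧_) (e i j)))

edges-∪ : ∀ G H → edges (G ∪ H) ≡ edges G + edges H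
edges-∪ G H = edges-join (n G) (n H) (adj G) (adj H)
  where
  edges-join : ∀ m k (a : Adj m) (b : Adj k) →
    edges (mkGraph (m + k) (joinAdj a b)) ≡ edges (mkGraph m a) + edges (mkGraph k b)
  edges-join zero    k a b = refl
  edges-join (suc m) k a b = begin
    countFin (λ j → joinAdj a b zero (suc j)) + edges (mkGraph (m + k) (dropVertex (joinAdj a b)))
      ≡⟨ cong₂ _+_ (countFin-↑ m k _) (edges-cong (joinAdj-suc a b)) ⟩
    countFin (λ j → joinAdj a b zero (suc (j ↑ˡ k))) + countFin (λ j → joinAdj a b zero (suc m ↑ʳ j))
      + edges (mkGraph (m + k) (joinAdj (dropVertex a) b))
      ≡⟨ cong₂ _+_ (cong₂ _+_ (countFin-cong (λ j → joinAdj-ˡˡ a b zero (suc j)))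
                              (countFin-false (joinAdj-ˡʳ {k = k} a b zero)))
                   (edges-join m k (dropVertex a) b) ⟩
    countFin (λ j → a zero (suc j)) + 0 + (edges (mkGraph m (dropVertex a)) + edges (mkGraph k b))
      ≡⟨ cong (_+ (edges (mkGraph m (dropVertex a)) + edges (mkGraph k b)))
              (+-identityʳ (countFin (λ j → a zero (suc j)))) ⟩
    countFin (λ j → a zero (suc j)) + (edges (mkGraph m (dropVertex a)) + edges (mkGraph k b))
      ≡⟨ +-assoc (countFin (λ j → a zero (suc j))) _ _ ⟨
    countFin (λ j → a zero (suc j)) + edges (mkGraph m (dropVertex a)) + edges (mkGraph k b) ∎
    where open ≡-Reasoning

edges-K : ∀ m → edges (K m) ≡ m C 2
edges-K zero    = refl
edges-K (suc m) = trans (cong₂ _+_ (trans (countFin-true m) (sym (nC1≡n m))) (edges-K m))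
                        (nCk+nC[k+1]≡[n+1]C[k+1] m 1)

edges-qK : ∀ q Δ → edges (qK q Δ) ≡ q * (suc Δ C 2)
edges-qK zero    Δ = refl
edges-qK (suc q) Δ = trans (edges-∪ (K (suc Δ)) (qK q Δ)) (cong₂ _+_ (edges-K (suc Δ)) (edges-qK q Δ))

↑-view : ∀ m k (z : Fin (m + k)) → (Σ (Fin m) λ x → z ≡ x ↑ˡ k) ⊎ (Σ (Fin k) λ y → z ≡ m ↑ʳ y)
↑-view m k z with splitAt m {k} z in eq
... | inj₁ x = inj₁ (x , sym (Fin.splitAt⁻¹-↑ˡ eq))
... | inj₂ y = inj₂ (y , sym (Fin.splitAt⁻¹-↑ʳ eq))

degree-∪ˡ : ∀ G H x → degree (G ∪ H) (x ↑ˡ n H) ≡ degree G x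
degree-∪ˡ G H x = trans (countFin-↑ (n G) (n H) _)
  (trans (cong₂ _+_ (countFin-cong (joinAdj-ˡˡ (adj G) (adj H) x)) (countFin-false (joinAdj-ˡʳ (adj G) (adj H) x)))
         (+-identityʳ _))

degree-∪ʳ : ∀ G H y → degree (G ∪ H) (n G ↑ʳ y) ≡ degree H y
degree-∪ʳ G H y = trans (countFin-↑ (n G) (n H) _)
  (cong₂ _+_ (countFin-false (joinAdj-ʳˡ (adj G) (adj H) y)) (countFin-cong (joinAdj-ʳʳ (adj G) (adj H) y)))

degree-qK : ∀ q Δ z → degree (qK q Δ) z ≡ Δ
degree-qK (suc q) Δ z with ↑-view (suc Δ) (n (qK q Δ)) z
... | inj₁ (x , refl) = trans (degree-∪ˡ (K (suc Δ)) (qK q Δ) x) (countFin-≢ Δ x)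
... | inj₂ (y , refl) = trans (degree-∪ʳ (K (suc Δ)) (qK q Δ) y) (degree-qK q Δ y)

↑ˡ≢↑ʳ : ∀ {m k} (x : Fin m) (y : Fin k) → x ↑ˡ k ≢ m ↑ʳ y
↑ˡ≢↑ʳ {m} {k} x y e with trans (sym (Fin.splitAt-↑ˡ m x k)) (trans (cong (splitAt m) e) (Fin.splitAt-↑ʳ m k y))
... | ()

∪-neighbourˡ : ∀ G H x z → adj (G ∪ H) (x ↑ˡ n H) z ≡ true → Σ (Fin (n G)) λ y → z ≡ y ↑ˡ n H
∪-neighbourˡ G H x z e with ↑-view (n G) (n H) z
... | inj₁ left = left
... | inj₂ (y , refl) = ⊥-elim (true≢false (trans (sym e) (joinAdj-ˡʳ (adj G) (adj H) x y)))

∪-neighbourʳ : ∀ G H y z → adj (G ∪ H) (n G ↑ʳ y) z ≡ true → Σ (Fin (n H)) λ y′ → z ≡ n G ↑ʳ y′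
∪-neighbourʳ G H y z e with ↑-view (n G) (n H) z
... | inj₂ right = right
... | inj₁ (x , refl) = ⊥-elim (true≢false (trans (sym e) (joinAdj-ʳˡ (adj G) (adj H) y x)))

nonIsolated-qK∪ : ∀ q Δ → 1 ≤ Δ → ∀ Y x → nonIsolated (qK q Δ ∪ Y) (x ↑ˡ n Y) ≡ true
nonIsolated-qK∪ q Δ Δ≥1 Y x =
  let (y , xy) = countFin-pos (adj (qK q Δ) x) (subst (1 ≤_) (sym (degree-qK q Δ x)) Δ≥1) in
  anyFin⁺ (y ↑ˡ n Y) (trans (joinAdj-ˡˡ (adj (qK q Δ)) (adj Y) x y) xy)

degreeSum : Graph → ℕ
degreeSum G = sumFin (degree G)

handshake : ∀ G → IsSimple G → degreeSum G ≡ edges G + edges G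
handshake G (symmetric , irreflexive) = begin
  sumFin (λ i → sumFin (λ j → ι (adj G i j)))
    ≡⟨ sumFin-cong (λ i → trans (sumFin-cong (split i)) (sumFin-+ (upper i) (λ j → upper j i))) ⟩
  sumFin (λ i → sumFin (upper i) + sumFin (λ j → upper j i))
    ≡⟨ sumFin-+ (λ i → sumFin (upper i)) _ ⟩
  edges G + sumFin (λ i → sumFin (λ j → upper j i))
    ≡⟨ cong (edges G +_) (sumFin-swap (λ i j → upper j i)) ⟩
  edges G + edges G ∎
  where
  open ≡-Reasoning
  upper : Fin (n G) → Fin (n G) → ℕ
  upper i j = ι ((toℕ i <ᵇ toℕ j) ∧ adj G i j)
  <ᵇ-asym : ∀ a b → (a <ᵇ b) ≡ true → (b <ᵇ a) ≡ false
  <ᵇ-asym zero    (suc b) _ = refl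
  <ᵇ-asym (suc a) (suc b) e = <ᵇ-asym a b e
  <ᵇ-tri : ∀ a b → (a <ᵇ b) ≡ false → (b <ᵇ a) ≡ false → a ≡ b
  <ᵇ-tri zero    zero    _ _ = refl
  <ᵇ-tri (suc a) (suc b) e f = cong suc (<ᵇ-tri a b e f)
  split : ∀ i j → ι (adj G i j) ≡ upper i j + upper j i
  split i j rewrite symmetric j i with toℕ i <ᵇ toℕ j in i<j | toℕ j <ᵇ toℕ i in j<i
  ... | true  | true  = ⊥-elim (true≢false (trans (sym j<i) (<ᵇ-asym (toℕ i) (toℕ j) i<j)))
  ... | true  | false = sym (+-identityʳ _)
  ... | false | true  = refl
  ... | false | false with Fin.toℕ-injective (<ᵇ-tri (toℕ i) (toℕ j) i<j j<i)
  ... | refl = cong ι (irreflexive i)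

IsSimple-K : ∀ m → IsSimple (K m)
IsSimple-K m = (λ i j → cong not (==ᶠ-sym i j)) , (λ i → cong not (==ᶠ-refl i))

IsSimple-∪ : ∀ G H → IsSimple G → IsSimple H → IsSimple (G ∪ H)
IsSimple-∪ G H (symG , irrG) (symH , irrH) = symmetric , irreflexive
  where
  symmetric : ∀ i j → adj (G ∪ H) i j ≡ adj (G ∪ H) j i
  symmetric i j with splitAt (n G) i | splitAt (n G) j
  ... | inj₁ x | inj₁ y = symG x y
  ... | inj₁ _ | inj₂ _ = refl
  ... | inj₂ _ | inj₁ _ = refl
  ... | inj₂ x | inj₂ y = symH x y
  irreflexive : ∀ i → adj (G ∪ H) i i ≡ false
  irreflexive i with splitAt (n G) i
  ... | inj₁ x = irrG x
  ... | inj₂ y = irrH y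

IsSimple-qK : ∀ q Δ → IsSimple (qK q Δ)
IsSimple-qK zero    Δ = (λ ()) , (λ ())
IsSimple-qK (suc q) Δ = IsSimple-∪ (K (suc Δ)) (qK q Δ) (IsSimple-K (suc Δ)) (IsSimple-qK q Δ)

-- Isomorphisms

true-irrelevant : ∀ {b : Bool} (p q : b ≡ true) → p ≡ q
true-irrelevant refl refl = refl

record SubsetBijection {n m} (P : Fin n → Bool) (Q : Fin m → Bool) : Set where
  field
    to      : ∀ i → P i ≡ true → Fin m
    to∈     : ∀ i p → Q (to i p) ≡ true
    from    : ∀ j → Q j ≡ true → Fin n
    from∈   : ∀ j q → P (from j q) ≡ true
    from-to : ∀ i p → from (to i p) (to∈ i p) ≡ i
    to-from : ∀ j q → to (from j q) (from∈ j q) ≡ j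

  to-cong : ∀ {i i′} → i ≡ i′ → ∀ p p′ → to i p ≡ to i′ p′
  to-cong refl p p′ = cong (to _) (true-irrelevant p p′)

  from-cong : ∀ {j j′} → j ≡ j′ → ∀ q q′ → from j q ≡ from j′ q′
  from-cong refl q q′ = cong (from _) (true-irrelevant q q′)

sumOver : ∀ {n} → (Fin n → Bool) → (Fin n → ℕ) → ℕ
sumOver P f = sumFin (λ i → if P i then f i else 0)

sumOver-remove : ∀ {m} (Q : Fin m → Bool) (g : Fin m → ℕ) j₀ → Q j₀ ≡ true →
  sumOver Q g ≡ g j₀ + sumOver (λ j → Q j ∧ not (j ==ᶠ j₀)) g
sumOver-remove Q g j₀ qj₀ =
  trans (sumFin-cong split) (trans (sumFin-+ (λ j → if j ==ᶠ j₀ then g j₀ else 0) _)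
        (cong (_+ sumOver (λ j → Q j ∧ not (j ==ᶠ j₀)) g) (sumFin-indicator j₀ (g j₀))))
  where
  split : ∀ j →
    (if Q j then g j else 0) ≡ (if j ==ᶠ j₀ then g j₀ else 0) + (if Q j ∧ not (j ==ᶠ j₀) then g j else 0)
  split j with j ≟ j₀
  ... | yes refl rewrite qj₀ = sym (+-identityʳ _)
  ... | no _ with Q j
  ... | true  = refl
  ... | false = refl

-- Induction on the domain: vertex 0, when in P, is matched with its image, which is removed from Q.
sumOver-bijection : ∀ {n m} {P : Fin n → Bool} {Q : Fin m → Bool} (φ : SubsetBijection P Q)
  (f : Fin n → ℕ) (g : Fin m → ℕ) → (∀ i p → g (SubsetBijection.to φ i p) ≡ f i) →
  sumOver P f ≡ sumOver Q g
sumOver-bijection {zero} {P = P} {Q} φ f g _ = sym (sumFin-zero empty)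
  where
  empty : ∀ j → (if Q j then g j else 0) ≡ 0
  empty j with Q j in qj
  ... | false = refl
  ... | true with SubsetBijection.from φ j qj
  ... | ()
sumOver-bijection {suc n} {m} {P} {Q} φ f g g∘to≡f with P zero in p₀
... | false = sumOver-bijection φ′ (λ i → f (suc i)) g (λ i → g∘to≡f (suc i))
  where
  open SubsetBijection φ
  from≢0 : ∀ j q → zero ≢ from j q
  from≢0 j q eq = true≢false (trans (sym (from∈ j q)) (trans (cong P (sym eq)) p₀))
  φ′ : SubsetBijection (λ i → P (suc i)) Q
  φ′ = record
    { to      = λ i → to (suc i)
    ; to∈     = λ i → to∈ (suc i)
    ; from    = λ j q → punchOut (from≢0 j q)
    ; from∈   = λ j q → trans (cong P (Fin.punchIn-punchOut (from≢0 j q))) (from∈ j q)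
    ; from-to = λ i p → Fin.suc-injective
                          (trans (Fin.punchIn-punchOut (from≢0 _ (to∈ (suc i) p))) (from-to (suc i) p))
    ; to-from = λ j q → trans (to-cong (Fin.punchIn-punchOut (from≢0 j q)) _ (from∈ j q)) (to-from j q)
    }
... | true = begin
  f zero + sumOver (λ i → P (suc i)) (λ i → f (suc i))
    ≡⟨ cong₂ _+_ (sym (g∘to≡f zero p₀))
                 (sumOver-bijection φ′ (λ i → f (suc i)) g (λ i → g∘to≡f (suc i))) ⟩
  g j₀ + sumOver Q′ g
    ≡⟨ sumOver-remove Q g j₀ (to∈ zero p₀) ⟨
  sumOver Q g ∎
  where
  open ≡-Reasoning
  open SubsetBijection φ
  j₀ : Fin m
  j₀ = to zero p₀
  Q′ : Fin m → Bool
  Q′ j = Q j ∧ not (j ==ᶠ j₀)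
  Q′⁻ : ∀ j → Q′ j ≡ true → Q j ≡ true × j ≢ j₀
  Q′⁻ j q′ with Q j | j ≟ j₀
  ... | true | no j≢j₀ = refl , j≢j₀
  Q′⁺ : ∀ j → Q j ≡ true → j ≢ j₀ → Q′ j ≡ true
  Q′⁺ j q j≢j₀ rewrite q | ≢⇒==ᶠ-false j≢j₀ = refl
  from≢0 : ∀ j q → j ≢ j₀ → zero ≢ from j q
  from≢0 j q j≢j₀ eq = j≢j₀ (trans (sym (to-from j q)) (to-cong (sym eq) (from∈ j q) p₀))
  to≢j₀ : ∀ i p → to (suc i) p ≢ j₀
  to≢j₀ i p eq = Fin.0≢1+n (trans (sym (from-to zero p₀))
                                  (trans (from-cong (sym eq) (to∈ zero p₀) (to∈ (suc i) p)) (from-to (suc i) p)))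
  from′≢0 : ∀ j q′ → zero ≢ from j (proj₁ (Q′⁻ j q′))
  from′≢0 j q′ = from≢0 j _ (proj₂ (Q′⁻ j q′))
  φ′ : SubsetBijection (λ i → P (suc i)) Q′
  φ′ = record
    { to      = λ i → to (suc i)
    ; to∈     = λ i p → Q′⁺ (to (suc i) p) (to∈ (suc i) p) (to≢j₀ i p)
    ; from    = λ j q′ → punchOut (from′≢0 j q′)
    ; from∈   = λ j q′ → trans (cong P (Fin.punchIn-punchOut (from′≢0 j q′))) (from∈ j _)
    ; from-to = λ i p → Fin.suc-injective (trans (Fin.punchIn-punchOut (from′≢0 _ _))
                          (trans (from-cong refl _ (to∈ (suc i) p)) (from-to (suc i) p)))
    ; to-from = λ j q′ → trans (to-cong (Fin.punchIn-punchOut (from′≢0 j q′)) _ (from∈ j _)) (to-from j _)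
    }

countFin-bijection : ∀ {n m} {P : Fin n → Bool} {Q : Fin m → Bool} → SubsetBijection P Q →
  countFin P ≡ countFin Q
countFin-bijection φ = sumOver-bijection φ (λ _ → 1) (λ _ → 1) (λ _ _ → refl)

V*-≡ : ∀ {G} {x y : V* G} → proj₁ x ≡ proj₁ y → x ≡ y
V*-≡ {x = i , p} {y = .i , q} refl = cong (i ,_) (T-irrelevant p q)

nonIsolatedˡ : ∀ G {i j} → adj G i j ≡ true → nonIsolated G i ≡ true
nonIsolatedˡ G {j = j} e = anyFin⁺ j e

nonIsolatedʳ : ∀ G → IsSimple G → ∀ {i j} → adj G i j ≡ true → nonIsolated G j ≡ true
nonIsolatedʳ G (symmetric , _) {i} {j} e = anyFin⁺ i (trans (symmetric j i) e)

mk≅ : (G H : Graph)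
  (to : ∀ i → nonIsolated G i ≡ true → Fin (n H)) (to∈ : ∀ i p → nonIsolated H (to i p) ≡ true)
  (from : ∀ j → nonIsolated H j ≡ true → Fin (n G)) (from∈ : ∀ j q → nonIsolated G (from j q) ≡ true)
  (from-to : ∀ i p q → from (to i p) q ≡ i) (to-from : ∀ j q p → to (from j q) p ≡ j)
  (adj-to : ∀ i j p q → adj H (to i p) (to j q) ≡ adj G i j) → G ≅ H
mk≅ G H to to∈ from from∈ from-to to-from adj-to =
  mk↔ₛ′ f g (λ y → V*-≡ (to-from (proj₁ y) _ _)) (λ x → V*-≡ (from-to (proj₁ x) _ _)) ,
  λ _ _ → adj-to _ _ _ _
  where
  f : V* G → V* H
  f (i , p) = to i (T→≡ p) , ≡→T (to∈ i (T→≡ p))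
  g : V* H → V* G
  g (j , q) = from j (T→≡ q) , ≡→T (from∈ j (T→≡ q))

module ≅-Properties {G H : Graph} (φ : G ≅ H) where

  to : V* G → V* H
  to = Inverse.to (proj₁ φ)

  from : V* H → V* G
  from = Inverse.from (proj₁ φ)

  to-from : ∀ y → to (from y) ≡ y
  to-from = Inverse.strictlyInverseˡ (proj₁ φ)

  from-to : ∀ x → from (to x) ≡ x
  from-to = Inverse.strictlyInverseʳ (proj₁ φ)

  adj-to : ∀ x y → adj H (proj₁ (to x)) (proj₁ (to y)) ≡ adj G (proj₁ x) (proj₁ y)
  adj-to = proj₂ φ

  adj-from : ∀ x y → adj G (proj₁ (from x)) (proj₁ (from y)) ≡ adj H (proj₁ x) (proj₁ y)
  adj-from x y = trans (sym (adj-to (from x) (from y)))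
                       (cong₂ (λ a b → adj H (proj₁ a) (proj₁ b)) (to-from x) (to-from y))

  -- Only the neighbours of x need to be known to be non-isolated in H, not all of H to be simple.
  degree-≅ : IsSimple G → ∀ x → (∀ k → adj H (proj₁ (to x)) k ≡ true → nonIsolated H k ≡ true) →
    degree G (proj₁ x) ≡ degree H (proj₁ (to x))
  degree-≅ simpleG x nbrs = countFin-bijection (record
    { to      = λ j e → proj₁ (to (j , ≡→T (nonIsolatedʳ G simpleG e)))
    ; to∈     = λ j e → trans (adj-to x (j , _)) e
    ; from    = λ k e → proj₁ (from (k , ≡→T (nbrs k e)))
    ; from∈   = λ k e → trans (cong (λ z → adj G (proj₁ z) (proj₁ (from (k , _)))) (sym (from-to x)))
                              (trans (adj-from (to x) (k , _)) e)
    ; from-to = λ j e → trans (cong (λ z → proj₁ (from z)) (V*-≡ refl)) (cong proj₁ (from-to (j , _)))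
    ; to-from = λ k e → trans (cong (λ z → proj₁ (to z)) (V*-≡ refl)) (cong proj₁ (to-from (k , _)))
    })

  degreeSum-≅ : IsSimple G → IsSimple H → degreeSum G ≡ degreeSum H
  degreeSum-≅ simpleG simpleH = trans (nonIsolated-only G) (trans (sumOver-bijection (record
    { to      = λ i p → proj₁ (to (i , ≡→T p))
    ; to∈     = λ i p → T→≡ (proj₂ (to (i , ≡→T p)))
    ; from    = λ j q → proj₁ (from (j , ≡→T q))
    ; from∈   = λ j q → T→≡ (proj₂ (from (j , ≡→T q)))
    ; from-to = λ i p → trans (cong (λ z → proj₁ (from z)) (V*-≡ refl)) (cong proj₁ (from-to (i , ≡→T p)))
    ; to-from = λ j q → trans (cong (λ z → proj₁ (to z)) (V*-≡ refl)) (cong proj₁ (to-from (j , ≡→T q)))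
    }) (degree G) (degree H)
    (λ i p → sym (degree-≅ simpleG (i , ≡→T p) (λ k e → nonIsolatedʳ H simpleH e)))) (sym (nonIsolated-only H)))
    where
    nonIsolated-only : ∀ F → degreeSum F ≡ sumOver (nonIsolated F) (degree F)
    nonIsolated-only F = sumFin-cong isolated-zero
      where
      isolated-zero : ∀ i → degree F i ≡ (if nonIsolated F i then degree F i else 0)
      isolated-zero i with nonIsolated F i in e
      ... | true  = refl
      ... | false = anyFin-false⇒countFin-zero {f = adj F i} e

  edges-≅ : IsSimple G → IsSimple H → edges G ≡ edges H
  edges-≅ simpleG simpleH = trans (n≡⌊n+n/2⌋ (edges G)) (trans (cong ⌊_/2⌋
    (trans (sym (handshake G simpleG)) (trans (degreeSum-≅ simpleG simpleH) (handshake H simpleH))))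
    (sym (n≡⌊n+n/2⌋ (edges H))))

clique-nonIsolated : ∀ {r} G (f : Fin r → Fin (n G)) → 2 ≤ r →
  (∀ i j → i ≢ j → adj G (f i) (f j) ≡ true) → ∀ i → nonIsolated G (f i) ≡ true
clique-nonIsolated G f (s≤s (s≤s _)) c zero    = nonIsolatedˡ G (c zero (suc zero) (λ ()))
clique-nonIsolated G f (s≤s (s≤s _)) c (suc i) = nonIsolatedˡ G (c (suc i) zero (λ ()))

ContainsK-≅ : ∀ {r} A B → A ≅ B → 2 ≤ r → ContainsK r B → ContainsK r A
ContainsK-≅ A B φ r≥2 (f , c) =
  (λ i → proj₁ (from (f i , ≡→T (clique-nonIsolated B f r≥2 c i)))) ,
  λ i j i≢j → trans (adj-from _ _) (c i j i≢j)
  where open ≅-Properties φ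

ContainsK-colex : ∀ r s → ContainsK r (colex r s)
ContainsK-colex r s = inject₁ , clique
  where
  inject₁<r : ∀ {r} (i : Fin r) → (toℕ (inject₁ i) <ᵇ r) ≡ true
  inject₁<r {suc r} zero    = refl
  inject₁<r {suc r} (suc i) = inject₁<r i
  clique : ∀ i j → i ≢ j → adj (colex r s) (inject₁ i) (inject₁ j) ≡ true
  clique i j i≢j
    rewrite ≢⇒==ᶠ-false (λ e → i≢j (Fin.inject₁-injective e)) | inject₁<r i | inject₁<r j = refl

-- Deleting an edge

CliqueThrough : ℕ → (G : Graph) → Fin (n G) → Fin (n G) → Set
CliqueThrough t G u v = Σ (Fin t → Fin (n G)) λ f →
  (∀ i j → i ≢ j → adj G (f i) (f j) ≡ true) × Σ (Fin t) (λ i → f i ≡ u) × Σ (Fin t) (λ j → f j ≡ v)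

countList-same⊎witness : ∀ {A : Set} (p q : A → Bool) xs → (∀ x → q x ≡ true → p x ≡ true) →
  countList q xs ≡ countList p xs ⊎ Σ A λ x → p x ≡ true × q x ≡ false
countList-same⊎witness p q []       q⊆p = inj₁ refl
countList-same⊎witness p q (x ∷ xs) q⊆p with countList-same⊎witness p q xs q⊆p
... | inj₂ w = inj₂ w
... | inj₁ e with q x in qx | p x in px
... | true  | true  = inj₁ (cong suc e)
... | true  | false = ⊥-elim (true≢false (trans (sym (q⊆p x qx)) px))
... | false | false = inj₁ e
... | false | true  = inj₂ (x , px , qx)

enumerate : ∀ {N} (S : Vec Bool N) → Fin (size S) → Fin N
enumerate (true  ∷ S) zero    = zero
enumerate (true  ∷ S) (suc k) = suc (enumerate S k)
enumerate (false ∷ S) k       = suc (enumerate S k)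

enumerate-∈ : ∀ {N} (S : Vec Bool N) k → lookup S (enumerate S k) ≡ true
enumerate-∈ (true  ∷ S) zero    = refl
enumerate-∈ (true  ∷ S) (suc k) = enumerate-∈ S k
enumerate-∈ (false ∷ S) k       = enumerate-∈ S k

enumerate-injective : ∀ {N} (S : Vec Bool N) k k′ → enumerate S k ≡ enumerate S k′ → k ≡ k′
enumerate-injective (true  ∷ S) zero    zero     _ = refl
enumerate-injective (true  ∷ S) (suc k) (suc k′) e = cong suc (enumerate-injective S k k′ (Fin.suc-injective e))
enumerate-injective (false ∷ S) k       k′       e = enumerate-injective S k k′ (Fin.suc-injective e)

enumerate-surjective : ∀ {N} (S : Vec Bool N) i → lookup S i ≡ true → Σ (Fin (size S)) λ k → enumerate S k ≡ i
enumerate-surjective (true  ∷ S) zero    _  = zero , refl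
enumerate-surjective (true  ∷ S) (suc i) si = let (k , e) = enumerate-surjective S i si in suc k , cong suc e
enumerate-surjective (false ∷ S) (suc i) si = let (k , e) = enumerate-surjective S i si in k , cong suc e

module DeleteEdge (G : Graph) (simple : IsSimple G) (u v : Fin (n G)) (uv∈G : adj G u v ≡ true) where

  private
    N : ℕ
    N = n G

  u≢v : u ≢ v
  u≢v refl = true≢false (trans (sym uv∈G) (proj₂ simple u))

  isUV : Fin N → Fin N → Bool
  isUV i j = (i ==ᶠ u ∧ j ==ᶠ v) ∨ (i ==ᶠ v ∧ j ==ᶠ u)

  isUV-sym : ∀ i j → isUV i j ≡ isUV j i
  isUV-sym i j = trans (∨-comm (i ==ᶠ u ∧ j ==ᶠ v) (i ==ᶠ v ∧ j ==ᶠ u))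
                       (cong₂ _∨_ (∧-comm (i ==ᶠ v) (j ==ᶠ u)) (∧-comm (i ==ᶠ u) (j ==ᶠ v)))

  isUV⁻ : ∀ i j → isUV i j ≡ true → (i ≡ u × j ≡ v) ⊎ (i ≡ v × j ≡ u)
  isUV⁻ i j e with ∨-true⁻ e
  ... | inj₁ p = let (a , b) = ∧-true⁻ p in inj₁ (==ᶠ⇒≡ a , ==ᶠ⇒≡ b)
  ... | inj₂ p = let (a , b) = ∧-true⁻ p in inj₂ (==ᶠ⇒≡ a , ==ᶠ⇒≡ b)

  isUV⊆G : ∀ i j → isUV i j ≡ true → adj G i j ≡ true
  isUV⊆G i j e with isUV⁻ i j e
  ... | inj₁ (refl , refl) = uv∈G
  ... | inj₂ (refl , refl) = trans (proj₁ simple v u) uv∈G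

  G′ : Graph
  G′ = mkGraph N (λ i j → adj G i j ∧ not (isUV i j))

  IsSimple-G′ : IsSimple G′
  IsSimple-G′ = (λ i j → cong₂ _∧_ (proj₁ simple i j) (cong not (isUV-sym i j)))
              , (λ i → cong (_∧ not (isUV i i)) (proj₂ simple i))

  G′⊆G : ∀ i j → adj G′ i j ≡ true → adj G i j ≡ true
  G′⊆G i j e = proj₁ (∧-true⁻ e)

  G⊆G′ : ∀ i j → adj G i j ≡ true → isUV i j ≡ false → adj G′ i j ≡ true
  G⊆G′ i j a b rewrite a | b = refl

  MaxDegLe-G′ : ∀ Δ → MaxDegLe G Δ → MaxDegLe G′ Δ
  MaxDegLe-G′ Δ maxDeg i = ≤-trans (countFin-mono (G′⊆G i)) (maxDeg i)

  degree-G : ∀ i → degree G i ≡ degree G′ i + (ι (i ==ᶠ u) + ι (i ==ᶠ v))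
  degree-G i = trans (sumFin-cong split) (trans (sumFin-+ (λ j → ι (adj G′ i j)) (λ j → ι (isUV i j)))
                                                (cong (degree G′ i +_) row))
    where
    split : ∀ j → ι (adj G i j) ≡ ι (adj G′ i j) + ι (isUV i j)
    split j with isUV i j in e
    ... | true rewrite isUV⊆G i j e = refl
    ... | false with adj G i j
    ... | true  = refl
    ... | false = refl
    row : countFin (isUV i) ≡ ι (i ==ᶠ u) + ι (i ==ᶠ v)
    row with i ==ᶠ u in iu | i ==ᶠ v in iv
    ... | true  | true  = ⊥-elim (u≢v (trans (sym (==ᶠ⇒≡ {i = i} iu)) (==ᶠ⇒≡ {i = i} iv)))
    ... | true  | false = trans (countFin-cong (λ j → ∨-identityʳ (j ==ᶠ v))) (countFin-≡ v)
    ... | false | true  = countFin-≡ u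
    ... | false | false = countFin-false {f = λ j → (false ∧ j ==ᶠ v) ∨ (false ∧ j ==ᶠ u)} (λ _ → refl)

  degree-u : degree G u ≡ suc (degree G′ u)
  degree-u = trans (degree-G u) (trans (cong (λ b → degree G′ u + (ι b + ι (u ==ᶠ v))) (==ᶠ-refl u))
    (trans (cong (λ b → degree G′ u + (1 + ι b)) (≢⇒==ᶠ-false u≢v)) (+-comm (degree G′ u) 1)))

  degree-v : degree G v ≡ suc (degree G′ v)
  degree-v = trans (degree-G v)
    (trans (cong (λ b → degree G′ v + (ι b + ι (v ==ᶠ v))) (≢⇒==ᶠ-false (u≢v ∘ sym)))
    (trans (cong (λ b → degree G′ v + ι b) (==ᶠ-refl v)) (+-comm (degree G′ v) 1)))

  edges-G : edges G ≡ suc (edges G′)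
  edges-G = trans (n≡⌊n+n/2⌋ (edges G)) (trans (cong ⌊_/2⌋ (begin
    edges G + edges G
      ≡⟨ handshake G simple ⟨
    degreeSum G
      ≡⟨ trans (sumFin-cong degree-G) (sumFin-+ (degree G′) _) ⟩
    degreeSum G′ + sumFin (λ i → ι (i ==ᶠ u) + ι (i ==ᶠ v))
      ≡⟨ cong (degreeSum G′ +_)
              (trans (sumFin-+ (λ i → ι (i ==ᶠ u)) _) (cong₂ _+_ (countFin-≡ u) (countFin-≡ v))) ⟩
    degreeSum G′ + 2
      ≡⟨ cong (_+ 2) (handshake G′ IsSimple-G′) ⟩
    edges G′ + edges G′ + 2
      ≡⟨ +-comm (edges G′ + edges G′) 2 ⟩
    suc (suc (edges G′ + edges G′))
      ≡⟨ cong suc (+-suc (edges G′) (edges G′)) ⟨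
    suc (edges G′) + suc (edges G′) ∎)) (sym (n≡⌊n+n/2⌋ (suc (edges G′)))))
    where open ≡-Reasoning

  private
    cliqueB : (F : Graph) → ℕ → Vec Bool (n F) → Bool
    cliqueB F t S = sizeIs t S ∧ isCliqueB F S

    cliqueB-G′⇒G : ∀ t S → cliqueB G′ t S ≡ true → cliqueB G t S ≡ true
    cliqueB-G′⇒G t S e = let (size≡t , cl) = ∧-true⁻ {sizeIs t S} e in
      ∧-true⁺ size≡t (isCliqueB⁺ (adj G) S (λ i j si sj i≢j →
        G′⊆G i j (isCliqueB⁻ (adj G′) S cl i j si sj i≢j)))

    cliqueB-G⇒G′ : ∀ t S → cliqueB G t S ≡ true → lookup S u ≡ false ⊎ lookup S v ≡ false →
      cliqueB G′ t S ≡ true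
    cliqueB-G⇒G′ t S e missing = let (size≡t , cl) = ∧-true⁻ {sizeIs t S} e in
      ∧-true⁺ size≡t (isCliqueB⁺ (adj G′) S (λ i j si sj i≢j →
        G⊆G′ i j (isCliqueB⁻ (adj G) S cl i j si sj i≢j)
                 (≢true⇒≡false (λ e → avoid si sj (isUV⁻ i j e) missing))))
      where
      avoid : ∀ {i j} → lookup S i ≡ true → lookup S j ≡ true →
        (i ≡ u × j ≡ v) ⊎ (i ≡ v × j ≡ u) → lookup S u ≡ false ⊎ lookup S v ≡ false → ⊥
      avoid si sj (inj₁ (refl , refl)) (inj₁ su) = true≢false (trans (sym si) su)
      avoid si sj (inj₁ (refl , refl)) (inj₂ sv) = true≢false (trans (sym sj) sv)
      avoid si sj (inj₂ (refl , refl)) (inj₁ su) = true≢false (trans (sym sj) su)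
      avoid si sj (inj₂ (refl , refl)) (inj₂ sv) = true≢false (trans (sym si) sv)

    through : ∀ t S → size S ≡ t → IsClique (adj G) S → lookup S u ≡ true → lookup S v ≡ true →
      CliqueThrough t G u v
    through _ S refl c su sv =
      enumerate S
      , (λ i j i≢j → c _ _ (enumerate-∈ S i) (enumerate-∈ S j) (λ e → i≢j (enumerate-injective S i j e)))
      , enumerate-surjective S u su , enumerate-surjective S v sv

  kt-G′⊎clique : ∀ t → kt t G′ ≡ kt t G ⊎ CliqueThrough t G u v
  kt-G′⊎clique t with countList-same⊎witness (cliqueB G t) (cliqueB G′ t) (subsets N) (cliqueB-G′⇒G t)
  ... | inj₁ same = inj₁ same
  ... | inj₂ (S , inG , notInG′) with lookup S u in su | lookup S v in sv
  ... | true  | true  = let (size≡t , cl) = ∧-true⁻ {sizeIs t S} inG in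
    inj₂ (through t S (≡ᵇ⇒≡ (size S) t (≡→T size≡t)) (isCliqueB⁻ (adj G) S cl) su sv)
  ... | false | _     = ⊥-elim (true≢false (trans (sym (cliqueB-G⇒G′ t S inG (inj₁ su))) notInG′))
  ... | true  | false = ⊥-elim (true≢false (trans (sym (cliqueB-G⇒G′ t S inG (inj₂ sv))) notInG′))

-- Adding the edge back

module Rebuild (Δ q : ℕ) (Δ≥1 : 1 ≤ Δ) (G : Graph) (simple : IsSimple G) (maxDeg : MaxDegLe G Δ)
               (u v : Fin (n G)) (uv∈G : adj G u v ≡ true) (L : Graph)
               (φ : DeleteEdge.G′ G simple u v uv∈G ≅ (qK q Δ ∪ L)) where

  open DeleteEdge G simple u v uv∈G
  open ≅-Properties φ

  private
    Q H : Graph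
    Q = qK q Δ
    H = Q ∪ L
    N : ℕ
    N = n G

  fromQ* : Fin (n Q) → V* G′
  fromQ* x = from (x ↑ˡ n L , ≡→T (nonIsolated-qK∪ q Δ Δ≥1 L x))

  fromQ : Fin (n Q) → Fin N
  fromQ x = proj₁ (fromQ* x)

  to-fromQ : ∀ x p → proj₁ (to (fromQ x , p)) ≡ x ↑ˡ n L
  to-fromQ x p = cong proj₁ (trans (cong to (V*-≡ refl)) (to-from _))

  fromQ-injective : ∀ x y → fromQ x ≡ fromQ y → x ≡ y
  fromQ-injective x y e = Fin.↑ˡ-injective (n L) x y
    (trans (sym (to-fromQ x (proj₂ (fromQ* x))))
           (trans (cong (λ w → proj₁ (to w)) (V*-≡ e)) (to-fromQ y (proj₂ (fromQ* y)))))

  -- whether w ends up in L rather than in one of the copies of K_{Δ+1}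
  inL : Fin N → Bool
  inL w = not (anyFin (λ x → fromQ x ==ᶠ w))

  qIndex : ∀ w → inL w ≡ false → Fin (n Q)
  qIndex w h = proj₁ (anyFin⁻ {f = λ x → fromQ x ==ᶠ w} (not-injective h))

  fromQ-qIndex : ∀ w h → fromQ (qIndex w h) ≡ w
  fromQ-qIndex w h = ==ᶠ⇒≡ (proj₂ (anyFin⁻ {f = λ x → fromQ x ==ᶠ w} (not-injective h)))

  inL-fromQ : ∀ x → inL (fromQ x) ≡ false
  inL-fromQ x = cong not (anyFin⁺ {f = λ y → fromQ y ==ᶠ fromQ x} x (==ᶠ-refl (fromQ x)))

  degree-fromQ : ∀ x → degree G′ (fromQ x) ≡ Δ
  degree-fromQ x = begin
    degree G′ (fromQ x)                     ≡⟨ degree-≅ IsSimple-G′ (from x′) nbrs ⟩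
    degree H (proj₁ (to (from x′)))         ≡⟨ cong (λ z → degree H (proj₁ z)) (to-from x′) ⟩
    degree H (x ↑ˡ n L)                     ≡⟨ degree-∪ˡ Q L x ⟩
    degree Q x                              ≡⟨ degree-qK q Δ x ⟩
    Δ                                       ∎
    where
    open ≡-Reasoning
    x′ : V* H
    x′ = (x ↑ˡ n L , ≡→T (nonIsolated-qK∪ q Δ Δ≥1 L x))
    nbrs : ∀ k → adj H (proj₁ (to (from x′))) k ≡ true → nonIsolated H k ≡ true
    nbrs k e rewrite to-from x′ with ∪-neighbourˡ Q L x k e
    ... | y , refl = nonIsolated-qK∪ q Δ Δ≥1 L y

  inL-deficient : ∀ w → degree G′ w < Δ → inL w ≡ true
  inL-deficient w deg<Δ with inL w in e
  ... | true  = refl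
  ... | false =
    ⊥-elim (<-irrefl (trans (cong (degree G′) (sym (fromQ-qIndex w e))) (degree-fromQ (qIndex w e))) deg<Δ)

  inL-u : inL u ≡ true
  inL-u = inL-deficient u (subst (_≤ Δ) degree-u (maxDeg u))

  inL-v : inL v ≡ true
  inL-v = inL-deficient v (subst (_≤ Δ) degree-v (maxDeg v))

  neighbour-of-fromQ : ∀ x b → adj G′ (fromQ x) b ≡ true → Σ (Fin (n Q)) λ y → fromQ y ≡ b
  neighbour-of-fromQ x b e =
    let (y , to-b≡y) = ∪-neighbourˡ Q L x (proj₁ (to b′)) toEdge
    in y , cong proj₁ (trans (cong from (V*-≡ (sym to-b≡y))) (from-to b′))
    where
    b′ : V* G′
    b′ = b , ≡→T (nonIsolatedʳ G′ IsSimple-G′ e)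
    toEdge : adj H (x ↑ˡ n L) (proj₁ (to b′)) ≡ true
    toEdge = trans (cong (λ z → adj H z (proj₁ (to b′))) (sym (to-fromQ x (proj₂ (fromQ* x)))))
                   (trans (adj-to (fromQ* x) b′) e)

  outside-L-closed : ∀ a b → inL a ≡ false → adj G′ a b ≡ true → inL b ≡ false
  outside-L-closed a b a∉L e =
    let (y , fromQy≡b) = neighbour-of-fromQ (qIndex a a∉L) b
                           (subst (λ z → adj G′ z b ≡ true) (sym (fromQ-qIndex a a∉L)) e)
    in subst (λ z → inL z ≡ false) fromQy≡b (inL-fromQ y)

  inL-edge : ∀ a b → adj G a b ≡ true → inL a ≡ inL b
  inL-edge a b e with isUV a b in uv
  ... | true with isUV⁻ a b uv
  ...   | inj₁ (refl , refl) = trans inL-u (sym inL-v)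
  ...   | inj₂ (refl , refl) = trans inL-v (sym inL-u)
  inL-edge a b e | false with inL a in ia | inL b in ib
  ... | true  | true  = refl
  ... | false | false = refl
  ... | false | true  = sym (trans (sym ib) (outside-L-closed a b ia (G⊆G′ a b e uv)))
  ... | true  | false =
    trans (sym ia) (outside-L-closed b a ib (trans (proj₁ IsSimple-G′ b a) (G⊆G′ a b e uv)))

  L′ : Graph
  L′ = mkGraph N (λ i j → adj G i j ∧ inL i ∧ inL j)

  private
    H′ : Graph
    H′ = Q ∪ L′

  private
    place : ∀ w b → inL w ≡ b → Fin (n Q + N)
    place w true  _ = n Q ↑ʳ w
    place w false h = qIndex w h ↑ˡ N

  toH′ : Fin N → Fin (n Q + N)
  toH′ w = place w (inL w) refl

  toH′-elim : ∀ w (P : Fin (n Q + N) → Set) →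
    (inL w ≡ true → P (n Q ↑ʳ w)) → ((h : inL w ≡ false) → P (qIndex w h ↑ˡ N)) → P (toH′ w)
  toH′-elim w P inside outside = elim (inL w) refl
    where
    elim : ∀ b (e : inL w ≡ b) → P (place w b e)
    elim true  e = inside e
    elim false e = outside e

  fromH′ : Fin (n Q + N) → Fin N
  fromH′ z = [ fromQ , id ] (splitAt (n Q) z)

  fromH′-ˡ : ∀ x → fromH′ (x ↑ˡ N) ≡ fromQ x
  fromH′-ˡ x rewrite Fin.splitAt-↑ˡ (n Q) x N = refl

  fromH′-ʳ : ∀ w → fromH′ (n Q ↑ʳ w) ≡ w
  fromH′-ʳ w rewrite Fin.splitAt-↑ʳ (n Q) N w = refl

  private
    adjH′-ʳʳ : ∀ a b → adj H′ (n Q ↑ʳ a) (n Q ↑ʳ b) ≡ adj L′ a b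
    adjH′-ʳʳ = joinAdj-ʳʳ (adj Q) (adj L′)

  inL-neighbour : ∀ a b → adj L′ a b ≡ true → inL a ≡ true
  inL-neighbour a b e = proj₁ (∧-true⁻ (proj₂ (∧-true⁻ {adj G a b} e)))

  fromQ-nonIsolated : ∀ x → nonIsolated G (fromQ x) ≡ true
  fromQ-nonIsolated x = let (k , e) = anyFin⁻ (T→≡ (proj₂ (fromQ* x))) in anyFin⁺ k (G′⊆G _ k e)

  fromQ-∉L : ∀ x → inL (fromQ x) ≡ true → ⊥
  fromQ-∉L x e = true≢false (trans (sym e) (inL-fromQ x))

  toH′-nonIsolated : ∀ i → nonIsolated G i ≡ true → nonIsolated H′ (toH′ i) ≡ true
  toH′-nonIsolated i p = toH′-elim i (λ z → nonIsolated H′ z ≡ true) inside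
    (λ h → nonIsolated-qK∪ q Δ Δ≥1 L′ (qIndex i h))
    where
    inside : inL i ≡ true → nonIsolated H′ (n Q ↑ʳ i) ≡ true
    inside i∈L = let (j , e) = anyFin⁻ p in
      anyFin⁺ (n Q ↑ʳ j)
        (trans (adjH′-ʳʳ i j) (∧-true⁺ e (∧-true⁺ i∈L (trans (sym (inL-edge i j e)) i∈L))))

  fromH′-nonIsolated : ∀ z → nonIsolated H′ z ≡ true → nonIsolated G (fromH′ z) ≡ true
  fromH′-nonIsolated z p with ↑-view (n Q) N z
  ... | inj₁ (x , refl) = subst (λ w → nonIsolated G w ≡ true) (sym (fromH′-ˡ x)) (fromQ-nonIsolated x)
  ... | inj₂ (w , refl) with anyFin⁻ p
  ... | k , e with ∪-neighbourʳ Q L′ w k e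
  ... | y , refl = subst (λ w → nonIsolated G w ≡ true) (sym (fromH′-ʳ w))
                         (anyFin⁺ y (proj₁ (∧-true⁻ (trans (sym (adjH′-ʳʳ w y)) e))))

  fromH′-toH′ : ∀ i → fromH′ (toH′ i) ≡ i
  fromH′-toH′ i = toH′-elim i (λ z → fromH′ z ≡ i) (λ _ → fromH′-ʳ i)
    (λ h → trans (fromH′-ˡ (qIndex i h)) (fromQ-qIndex i h))

  toH′-fromH′ : ∀ z → nonIsolated H′ z ≡ true → toH′ (fromH′ z) ≡ z
  toH′-fromH′ z p with ↑-view (n Q) N z
  ... | inj₁ (x , refl) rewrite fromH′-ˡ x =
    toH′-elim (fromQ x) (λ z → z ≡ x ↑ˡ N) (λ e → ⊥-elim (fromQ-∉L x e))
    (λ h → cong (_↑ˡ N) (fromQ-injective _ x (fromQ-qIndex (fromQ x) h)))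
  ... | inj₂ (w , refl) rewrite fromH′-ʳ w with anyFin⁻ p
  ... | k , e with ∪-neighbourʳ Q L′ w k e
  ... | y , refl = toH′-elim w (λ z → z ≡ n Q ↑ʳ w) (λ _ → refl)
    (λ h → ⊥-elim (true≢false (trans (sym (inL-neighbour w y (trans (sym (adjH′-ʳʳ w y)) e))) h)))

  no-edge-across : ∀ a b → inL a ≡ true → inL b ≡ false → adj G a b ≡ false
  no-edge-across a b a∈L b∉L =
    ≢true⇒≡false (λ e → true≢false (trans (sym a∈L) (trans (inL-edge a b e) b∉L)))

  isUV-outside : ∀ a b → inL a ≡ false → isUV a b ≡ false
  isUV-outside a b a∉L = ≢true⇒≡false (λ e → case (isUV⁻ a b e))
    where
    case : (a ≡ u × b ≡ v) ⊎ (a ≡ v × b ≡ u) → ⊥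
    case (inj₁ (refl , _)) = true≢false (trans (sym inL-u) a∉L)
    case (inj₂ (refl , _)) = true≢false (trans (sym inL-v) a∉L)

  adj-qIndex : ∀ a b (ha : inL a ≡ false) (hb : inL b ≡ false) → adj Q (qIndex a ha) (qIndex b hb) ≡ adj G a b
  adj-qIndex a b ha hb = begin
    adj Q x y                      ≡⟨ joinAdj-ˡˡ (adj Q) (adj L) x y ⟨
    adj H (x ↑ˡ n L) (y ↑ˡ n L)    ≡⟨ adj-from _ _ ⟨
    adj G′ (fromQ x) (fromQ y)     ≡⟨ cong₂ (adj G′) (fromQ-qIndex a ha) (fromQ-qIndex b hb) ⟩
    adj G a b ∧ not (isUV a b)     ≡⟨ cong (λ c → adj G a b ∧ not c) (isUV-outside a b ha) ⟩
    adj G a b ∧ true               ≡⟨ ∧-identityʳ (adj G a b) ⟩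
    adj G a b                      ∎
    where
    open ≡-Reasoning
    x y : Fin (n Q)
    x = qIndex a ha
    y = qIndex b hb

  adj-toH′ : ∀ i j → adj H′ (toH′ i) (toH′ j) ≡ adj G i j
  adj-toH′ i j = toH′-elim i (λ z → adj H′ z (toH′ j) ≡ adj G i j)
    (λ i∈L → toH′-elim j (λ z → adj H′ (n Q ↑ʳ i) z ≡ adj G i j)
      (λ j∈L → trans (adjH′-ʳʳ i j)
                     (trans (cong₂ (λ a b → adj G i j ∧ a ∧ b) i∈L j∈L) (∧-identityʳ (adj G i j))))
      (λ j∉L → trans (joinAdj-ʳˡ (adj Q) (adj L′) i _) (sym (no-edge-across i j i∈L j∉L))))
    (λ i∉L → toH′-elim j (λ z → adj H′ (qIndex i i∉L ↑ˡ N) z ≡ adj G i j)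
      (λ j∈L → trans (joinAdj-ˡʳ (adj Q) (adj L′) _ j)
                     (sym (trans (proj₁ simple i j) (no-edge-across j i j∈L i∉L))))
      (λ j∉L → trans (joinAdj-ˡˡ (adj Q) (adj L′) _ _) (adj-qIndex i j i∉L j∉L)))

  G≅qK∪L′ : G ≅ (qK q Δ ∪ L′)
  G≅qK∪L′ = mk≅ G H′ (λ i _ → toH′ i) toH′-nonIsolated (λ z _ → fromH′ z) fromH′-nonIsolated
    (λ i _ _ → fromH′-toH′ i) (λ z p _ → toH′-fromH′ z p) (λ i j _ _ → adj-toH′ i j)

  IsSimple-L′ : IsSimple L′
  IsSimple-L′ = (λ i j → trans (cong (_∧ (inL i ∧ inL j)) (proj₁ simple i j))
                                (cong (adj G j i ∧_) (∧-comm (inL i) (inL j))))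
              , (λ i → cong (_∧ (inL i ∧ inL i)) (proj₂ simple i))

  MaxDegLe-L′ : MaxDegLe L′ Δ
  MaxDegLe-L′ i = ≤-trans (countFin-mono {f = adj L′ i} (λ j e → proj₁ (∧-true⁻ {adj G i j} e))) (maxDeg i)

  edges-L′ : edges G ≡ q * (suc Δ C 2) + edges L′
  edges-L′ = trans (≅-Properties.edges-≅ G≅qK∪L′ simple (IsSimple-∪ Q L′ (IsSimple-qK q Δ) IsSimple-L′))
                   (trans (edges-∪ Q L′) (cong (_+ edges L′) (edges-qK q Δ)))

  fromL-∈L : ∀ y p → inL (proj₁ (from (n Q ↑ʳ y , p))) ≡ true
  fromL-∈L y p with inL (proj₁ (from (n Q ↑ʳ y , p))) in e
  ... | true  = refl
  ... | false = let x = qIndex _ e in ⊥-elim (↑ˡ≢↑ʳ x y (trans (sym (to-fromQ x (proj₂ (fromQ* x))))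
                  (trans (cong (λ w → proj₁ (to w)) (V*-≡ (fromQ-qIndex _ e))) (cong proj₁ (to-from _)))))

  ContainsK-L′ : ∀ {r} → 2 ≤ r → ContainsK r L → ContainsK r L′
  ContainsK-L′ {r} r≥2 (g , clique) =
    w , λ i j i≢j → ∧-true⁺ (adj-w i j i≢j) (∧-true⁺ (w∈L i) (w∈L j))
    where
    z : Fin r → Fin (n Q + n L)
    z i = n Q ↑ʳ g i
    z-clique : ∀ i j → i ≢ j → adj H (z i) (z j) ≡ true
    z-clique i j i≢j = trans (joinAdj-ʳʳ (adj Q) (adj L) (g i) (g j)) (clique i j i≢j)
    z* : Fin r → V* H
    z* i = z i , ≡→T (clique-nonIsolated H z r≥2 z-clique i)
    w : Fin r → Fin N
    w i = proj₁ (from (z* i))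
    adj-w : ∀ i j → i ≢ j → adj G (w i) (w j) ≡ true
    adj-w i j i≢j = G′⊆G _ _ (trans (adj-from (z* i) (z* j)) (z-clique i j i≢j))
    w∈L : ∀ i → inL (w i) ≡ true
    w∈L i = fromL-∈L (g i) _

-- A minimum counterexample without K_t through the edge uv

module EdgeInNoClique (t₁ Δ₁ : ℕ) (t₁≥2 : 2 ≤ t₁) (t≤Δ+1 : suc t₁ ≤ suc Δ₁ + 1) (G : Graph)
                      (mc : MinCounterexample (suc t₁) (suc Δ₁) G)
                      (u v : Fin (n G)) (uv∈G : adj G u v ≡ true)
                      (same : kt (suc t₁) (DeleteEdge.G′ G (MinCounterexample.simple mc) u v uv∈G)
                              ≡ kt (suc t₁) G) where

  open MinCounterexample mc using (simple; maxDeg; minimal)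
  open DeleteEdge G simple u v uv∈G

  private
    t Δ : ℕ
    t = suc t₁
    Δ = suc Δ₁

  extremal : ℕ → ℕ → ℕ → ℕ
  extremal q r s = q * (suc Δ C t) + (r C t + s C t₁)

  kt-extremal : ∀ q r s → s ≤ r → kt t (qK q Δ ∪ colex r s) ≡ extremal q r s
  kt-extremal q r s s≤r =
    trans (kt-∪ t₁ (qK q Δ) (colex r s)) (cong₂ _+_ (kt-qK t₁ q Δ) (kt-colex t₁ r s s≤r))

  minimality-G′ : ∀ q r s → s < r → r ≤ Δ → edges G′ ≡ q * (suc Δ C 2) + (r C 2 + s) →
    kt t G′ ≤ extremal q r s
    × (kt t G′ ≡ extremal q r s → Σ Graph λ L → InFam t Δ (r C 2 + s) L × G′ ≅ (qK q Δ ∪ L))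
  minimality-G′ q r s s<r r≤Δ edges-G′ =
    let (≤kt-extremal , ≡kt-extremal⇒) =
          minimal G′ IsSimple-G′ (MaxDegLe-G′ Δ maxDeg) (≤-reflexive (sym edges-G))
                  q (r C 2 + s) (C2+<C2 r s Δ s<r r≤Δ) edges-G′ r s s<r refl
    in subst (kt t G′ ≤_) (kt-extremal q r s (<⇒≤ s<r)) ≤kt-extremal ,
       λ e → ≡kt-extremal⇒ (trans e (sym (kt-extremal q r s (<⇒≤ s<r))))

  shortfall : ∀ q r s d → s < r → r ≤ Δ → edges G′ ≡ q * (suc Δ C 2) + (r C 2 + s) →
    extremal q r s + d ≤ kt t G′ →
    d ≡ 0 × Σ Graph λ L → InFam t Δ (r C 2 + s) L × G′ ≅ (qK q Δ ∪ L)
  shortfall q r s d s<r r≤Δ edges-G′ lower =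
    let (upper , extremal⇒) = minimality-G′ q r s s<r r≤Δ edges-G′
    in n≤0⇒n≡0 (+-cancelˡ-≤ (extremal q r s) d 0
                 (≤-trans (≤-trans lower upper) (≤-reflexive (sym (+-identityʳ _))))) ,
       extremal⇒ (≤-antisym upper (≤-trans (m≤m+n _ d) lower))

  private
    t₁≥1 : 1 ≤ t₁
    t₁≥1 = ≤-trans (s≤s z≤n) t₁≥2

    t≤r⇒2≤r : ∀ {r} → t ≤ r → 2 ≤ r
    t≤r⇒2≤r t≤r = ≤-trans (s≤s t₁≥1) t≤r

  InFam⇒ContainsK : ∀ {r s L} → s < r → s < t₁ ∸ 1 → InFam t Δ (r C 2 + s) L → t ≤ r → ContainsK r L
  InFam⇒ContainsK {r} s<r _ (inj₁ (m≡0 , _)) t≤r =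
    ⊥-elim (1+n≰n (≤-trans (C-pos r 2 (t≤r⇒2≤r t≤r)) (≤-trans (m≤m+n (r C 2) _) (≤-reflexive m≡0))))
  InFam⇒ContainsK {r} {s} {L} s<r small (inj₂ (r′ , s′ , s′<r′ , m≡ , _ , _ , branch)) t≤r
    with C2+-injective r s r′ s′ s<r s′<r′ m≡
  ... | refl , refl with branch
  ...   | inj₁ (t₁≤s , _) = ⊥-elim (<⇒≱ (<∸1⇒suc< t₁ small) (m≤n⇒m≤1+n t₁≤s))
  ...   | inj₂ (inj₁ (_ , _ , inj₁ L≅colex)) =
    ContainsK-≅ L (colex r s) L≅colex (t≤r⇒2≤r t≤r) (ContainsK-colex r s)
  ...   | inj₂ (inj₁ (_ , _ , inj₂ (_ , _ , _ , K))) = K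
  ...   | inj₂ (inj₂ (r<t , _)) = ⊥-elim (<-irrefl refl (≤-trans r<t t≤r))

  reinsert : ∀ q r s L → s < r → r ≤ Δ → suc (edges G′) ≡ q * (suc Δ C 2) + (r C 2 + s) → 0 < r C 2 + s →
    s < t₁ → G′ ≅ (qK q Δ ∪ L) → (t ≤ r → ContainsK r L) →
    Σ Graph λ L′ → InFam t Δ (r C 2 + s) L′ × G ≅ (qK q Δ ∪ L′)
  reinsert q r s L s<r r≤Δ edges≡ pos s<t₁ φ K-L = L′ , family , G≅qK∪L′
    where
    open Rebuild Δ q (s≤s z≤n) G simple maxDeg u v uv∈G L φ
    edges-L′≡ : edges L′ ≡ r C 2 + s
    edges-L′≡ = +-cancelˡ-≡ (q * (suc Δ C 2)) _ _ (trans (sym edges-L′) (trans edges-G edges≡))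
    fits : r C 2 + s ≤ suc Δ C 2
    fits = <⇒≤ (C2+<C2 r s Δ s<r r≤Δ)
    family : InFam t Δ (r C 2 + s) L′
    family with t ≤? r
    ... | yes t≤r = inj₂ (r , s , s<r , refl , pos , fits ,
                      inj₂ (inj₁ (t≤r , s<t₁ , inj₂ (IsSimple-L′ , edges-L′≡ , MaxDegLe-L′ ,
                                                     ContainsK-L′ (t≤r⇒2≤r t≤r) (K-L t≤r)))))
    ... | no  t≰r = inj₂ (r , s , s<r , refl , pos , fits ,
                      inj₂ (inj₂ (≰⇒> t≰r , inj₂ (IsSimple-L′ , edges-L′≡ , MaxDegLe-L′))))

  private
    regroup : ∀ a b c d → a + (b + (c + d)) ≡ a + (b + c) + d
    regroup a b c d = trans (cong (a +_) (sym (+-assoc b c d))) (sym (+-assoc a (b + c) d))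

  extremal-form-pred-s : ∀ q r s → suc s < r → r ≤ Δ → suc (edges G′) ≡ q * (suc Δ C 2) + (r C 2 + suc s) →
    extremal q r (suc s) ≤ kt t G′ → Σ Graph λ L → InFam t Δ (r C 2 + suc s) L × G ≅ (qK q Δ ∪ L)
  extremal-form-pred-s q r s s+1<r r≤Δ edges≡ lower =
    let (d≡0 , L , family , φ) = shortfall q r s (s C₋₁ t₁) s<r r≤Δ edges-G′ (subst (_≤ kt t G′) gap lower)
        small = C₋₁≡0⇒< s t₁ t₁≥1 d≡0
    in reinsert q r (suc s) L s+1<r r≤Δ edges≡ (≤-trans (s≤s z≤n) (m≤n+m (suc s) (r C 2)))
                (<∸1⇒suc< t₁ small) φ
                (InFam⇒ContainsK s<r small family)
    where
    s<r : s < r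
    s<r = <-trans (n<1+n s) s+1<r
    edges-G′ : edges G′ ≡ q * (suc Δ C 2) + (r C 2 + s)
    edges-G′ = suc-injective (trans edges≡ (trans (cong (q * (suc Δ C 2) +_) (+-suc (r C 2) s)) (+-suc _ _)))
    gap : extremal q r (suc s) ≡ extremal q r s + s C₋₁ t₁
    gap = trans (cong (λ x → q * (suc Δ C t) + (r C t + x)) (C-suc s t₁))
                (regroup (q * (suc Δ C t)) (r C t) (s C t₁) (s C₋₁ t₁))

  extremal-form-pred-r : ∀ q r → suc (suc r) ≤ Δ → suc (edges G′) ≡ q * (suc Δ C 2) + (suc (suc r) C 2 + 0) →
    extremal q (suc (suc r)) 0 ≤ kt t G′ →
    Σ Graph λ L → InFam t Δ (suc (suc r) C 2 + 0) L × G ≅ (qK q Δ ∪ L)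
  extremal-form-pred-r q r r+2≤Δ edges≡ lower =
    let (d≡0 , L , _ , φ) = shortfall q (suc r) r (r C₋₁ t₁) (n<1+n r) (≤-trans (n≤1+n _) r+2≤Δ) edges-G′
                                      (subst (_≤ kt t G′) gap lower)
        r+2<t = s≤s (<∸1⇒suc< t₁ (C₋₁≡0⇒< r t₁ t₁≥1 d≡0))
    in reinsert q (suc (suc r)) 0 L (s≤s z≤n) r+2≤Δ edges≡
                (≤-trans (C-pos (suc (suc r)) 2 (s≤s (s≤s z≤n))) (m≤m+n _ 0))
                t₁≥1 φ (λ t≤r+2 → ⊥-elim (<⇒≱ r+2<t t≤r+2))
    where
    edges-G′ : edges G′ ≡ q * (suc Δ C 2) + (suc r C 2 + r)
    edges-G′ = suc-injective (trans edges≡ (trans (cong (λ x → q * (suc Δ C 2) + (x + 0)) (C2-suc (suc r)))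
                                                 (shift (q * (suc Δ C 2)) r (suc r C 2))))
      where
      shift : ∀ a x y → a + (suc x + y + 0) ≡ suc (a + (y + x))
      shift = solve 3 (λ a x y → a :+ (con 1 :+ x :+ y :+ con 0) := con 1 :+ (a :+ (y :+ x))) refl
    gap : extremal q (suc (suc r)) 0 ≡ extremal q (suc r) r + r C₋₁ t₁
    gap = begin
      q * (suc Δ C t) + (suc (suc r) C t + 0 C t₁)
        ≡⟨ cong₂ (λ x y → q * (suc Δ C t) + (x + y)) (C-suc (suc r) t) (k>n⇒nCk≡0 t₁≥1) ⟩
      q * (suc Δ C t) + (suc r C t + suc r C t₁ + 0)
        ≡⟨ cong (λ x → q * (suc Δ C t) + x) (+-identityʳ _) ⟩
      q * (suc Δ C t) + (suc r C t + suc r C t₁)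
        ≡⟨ cong (λ x → q * (suc Δ C t) + (suc r C t + x)) (C-suc r t₁) ⟩
      q * (suc Δ C t) + (suc r C t + (r C t₁ + r C₋₁ t₁))
        ≡⟨ regroup (q * (suc Δ C t)) (suc r C t) (r C t₁) (r C₋₁ t₁) ⟩
      extremal q (suc r) r + r C₋₁ t₁ ∎
      where open ≡-Reasoning

  no-pred-q : ∀ q → suc (edges G′) ≡ suc q * (suc Δ C 2) + (1 C 2 + 0) →
    extremal (suc q) 1 0 ≤ kt t G′ → ⊥
  no-pred-q q edges≡ lower =
    n>0⇒n≢0 d-pos
      (proj₁ (shortfall q Δ Δ₁ (Δ₁ C₋₁ t₁) (n<1+n Δ₁) ≤-refl edges-G′ (subst (_≤ kt t G′) gap lower)))
    where
    d-pos : 1 ≤ Δ₁ C₋₁ t₁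
    d-pos = C₋₁-pos Δ₁ t₁ t₁≥1 (subst (t₁ ≤_) (+-comm Δ₁ 1) (≤-pred t≤Δ+1))
    edges-G′ : edges G′ ≡ q * (suc Δ C 2) + (Δ C 2 + Δ₁)
    edges-G′ = suc-injective (trans edges≡ (trans (cong (λ x → x + q * (suc Δ C 2) + 0) (C2-suc Δ))
                                                 (shift Δ₁ (Δ C 2) (q * (suc Δ C 2)))))
      where
      shift : ∀ x y a → suc x + y + a + 0 ≡ suc (a + (y + x))
      shift = solve 3 (λ x y a → con 1 :+ x :+ y :+ a :+ con 0 := con 1 :+ (a :+ (y :+ x))) refl
    gap : extremal (suc q) 1 0 ≡ extremal q Δ Δ₁ + Δ₁ C₋₁ t₁
    gap = begin
      suc q * (suc Δ C t) + (1 C t + 0 C t₁)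
        ≡⟨ cong₂ (λ x y → suc q * (suc Δ C t) + (x + y))
                 (k>n⇒nCk≡0 (s≤s t₁≥1)) (k>n⇒nCk≡0 t₁≥1) ⟩
      suc q * (suc Δ C t) + 0
        ≡⟨ trans (+-identityʳ _) (+-comm (suc Δ C t) (q * (suc Δ C t))) ⟩
      q * (suc Δ C t) + suc Δ C t
        ≡⟨ cong (λ x → q * (suc Δ C t) + x) (trans (C-suc Δ t) (cong (Δ C t +_) (C-suc Δ₁ t₁))) ⟩
      q * (suc Δ C t) + (Δ C t + (Δ₁ C t₁ + Δ₁ C₋₁ t₁))
        ≡⟨ regroup (q * (suc Δ C t)) (Δ C t) (Δ₁ C t₁) (Δ₁ C₋₁ t₁) ⟩
      extremal q Δ Δ₁ + Δ₁ C₋₁ t₁ ∎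
      where open ≡-Reasoning

  -- C(r,2) + s loses an edge in one of three ways:
  -- s ↦ s - 1;  (r, 0) ↦ (r - 1, r - 2);  (q, 1, 0) ↦ (q - 1, Δ, Δ - 1).
  extremal-form : ∀ q r s → 1 ≤ q → s < r → r ≤ Δ → suc (edges G′) ≡ q * (suc Δ C 2) + (r C 2 + s) →
    extremal q r s ≤ kt t G′ → Σ Graph λ L → InFam t Δ (r C 2 + s) L × G ≅ (qK q Δ ∪ L)
  extremal-form q       r             (suc s) _ s<r r≤Δ = extremal-form-pred-s q r s s<r r≤Δ
  extremal-form q       (suc (suc r)) zero    _ _   r≤Δ = extremal-form-pred-r q r r≤Δ
  extremal-form (suc q) 1             zero    _ _   _   = λ edges≡ lower → ⊥-elim (no-pred-q q edges≡ lower)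

  contradiction : ⊥
  contradiction = notExt (extremal-form q r s q≥1 s<r r≤Δ (trans (sym edges-G) edgesG) lower)
    where
    open MinCounterexample mc using (q; r; s; q≥1; s<r; r≤Δ; edgesG; many; notExt)
    lower : extremal q r s ≤ kt t G′
    lower = subst₂ _≤_ (+-assoc (q * (suc Δ C t)) (r C t) (s C t₁)) (sym same) many

lemma2p2 : (t Δ : ℕ) → 3 ≤ t → t ≤ Δ + 1 → (G : Graph) → MinCounterexample t Δ G →
    ∀ (u v : Fin (n G)) → adj G u v ≡ true →
      Σ (Fin t → Fin (n G)) λ f →
        (∀ i j → i ≢ j → adj G (f i) (f j) ≡ true)
        × Σ (Fin t) (λ i → f i ≡ u) × Σ (Fin t) (λ j → f j ≡ v)
lemma2p2 (suc zero)    zero (s≤s ()) _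
lemma2p2 (suc (suc _)) zero _ (s≤s ())
lemma2p2 (suc t₁) (suc Δ₁) (s≤s t₁≥2) t≤Δ+1 G mc u v uv∈G
  with DeleteEdge.kt-G′⊎clique G (MinCounterexample.simple mc) u v uv∈G (suc t₁)
... | inj₂ clique-through-uv = clique-through-uv
... | inj₁ same = ⊥-elim (EdgeInNoClique.contradiction t₁ Δ₁ t₁≥2 t≤Δ+1 G mc u v uv∈G same)
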